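{- Let $n\geq 3$ and let $k$ be an even integer with $3\leq k\leq 2^{n-1}$. Then $\kappa(Q_n;C_k)\geq \kappa^s(Q_n;C_k)=\lceil\frac{2n}{k}\rceil$.
   Context: $Q_n$ is the $n$-dimensional hypercube: its vertices are the binary strings of length $n$, two vertices being adjacent iff they differ in exactly one position. $C_k$ denotes the cycle of length $k$. For connected graphs $G,H$: an $H$-structure cut of $G$ is a set $F$ of subgraphs of $G$, each isomorphic to $H$, such that $G-V(F)$ is disconnected or trivial (a single vertex); an $H$-substructure cut is defined the same way except that each member of $F$ is isomorphic to a connected subgraph of $H$. $\kappa(G;H)$ (resp. $\kappa^s(G;H)$) is the minimum cardinality of an $H$-structure cut (resp. $H$-substructure cut) of $G$. -}

module Defs where

open import Data.Nat using (ℕ; zero; suc; _+_; _*_; _∸_; _^_; _≤_)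
open import Data.Nat.DivMod using (_/_)
open import Data.Nat.Divisibility using (_∣_)
open import Data.Fin using (Fin; toℕ)
open import Data.Bool using (Bool; true; false)
open import Data.Vec using (Vec; []; _∷_)
open import Data.List using (List; length)
open import Data.List.Membership.Propositional using (_∈_)
open import Data.Product using (Σ; ∃; _×_; _,_)
open import Data.Sum using (_⊎_)
open import Relation.Nullary using (¬_)
open import Relation.Binary.PropositionalEquality using (_≡_)

Vertex : ℕ → Set
Vertex n = Vec Bool n

diffBit : Bool → Bool → ℕ
diffBit true  true  = 0
diffBit false false = 0
diffBit _     _     = 1

hamming : ∀ {n} → Vertex n → Vertex n → ℕ
hamming []       []       = 0
hamming (a ∷ u)  (b ∷ v)  = diffBit a b + hamming u v

QAdj : ∀ {n} → Vertex n → Vertex n → Set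
QAdj u v = hamming u v ≡ 1

CAdj : (k : ℕ) → Fin k → Fin k → Set
CAdj zero    i j = Data.Empty.⊥ where import Data.Empty
CAdj (suc k) i j = (toℕ j ≡ (toℕ i + 1) % suc k) ⊎ (toℕ i ≡ (toℕ j + 1) % suc k)
  where open import Data.Nat.DivMod using (_%_)

-- A subgraph isomorphic to C_k in Q_n is the image of an injective map
-- f : Fin k → V(Q_n) sending cycle edges to hypercube edges.

record CycleCopy (n k : ℕ) : Set where
  field
    f     : Fin k → Vertex n
    inj   : ∀ i j → f i ≡ f j → i ≡ j
    edges : ∀ i j → CAdj k i j → QAdj (f i) (f j)

InCycleCopy : ∀ {n k} → CycleCopy n k → Vertex n → Set
InCycleCopy {k = k} c x = Σ (Fin k) λ i → CycleCopy.f c i ≡ x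

record SubOfCycle (k : ℕ) : Set where
  field
    P      : Fin k → Bool
    E      : Fin k → Fin k → Bool
    E⊆C    : ∀ i j → E i j ≡ true → CAdj k i j
    E-endˡ : ∀ i j → E i j ≡ true → P i ≡ true
    E-endʳ : ∀ i j → E i j ≡ true → P j ≡ true

data SReach {k : ℕ} (S : SubOfCycle k) : Fin k → Fin k → Set where
  here : ∀ {i} → SubOfCycle.P S i ≡ true → SReach S i i
  step : ∀ {i j l} → SReach S i j →
         (SubOfCycle.E S j l ≡ true ⊎ SubOfCycle.E S l j ≡ true) →
         SReach S i l

ConnectedSub : ∀ {k} → SubOfCycle k → Set
ConnectedSub {k} S =
  (Σ (Fin k) λ i → SubOfCycle.P S i ≡ true) ×
  (∀ i j → SubOfCycle.P S i ≡ true → SubOfCycle.P S j ≡ true → SReach S i j)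

-- A subgraph of Q_n isomorphic to a connected subgraph S of C_k is the
-- image of S under a map injective on V(S) sending edges of S to edges of Q_n.
record SubCycleCopy (n k : ℕ) : Set where
  field
    S     : SubOfCycle k
    conn  : ConnectedSub S
    f     : Fin k → Vertex n
    inj   : ∀ i j → SubOfCycle.P S i ≡ true → SubOfCycle.P S j ≡ true →
            f i ≡ f j → i ≡ j
    edges : ∀ i j → SubOfCycle.E S i j ≡ true → QAdj (f i) (f j)

InSubCycleCopy : ∀ {n k} → SubCycleCopy n k → Vertex n → Set
InSubCycleCopy {k = k} c x =
  Σ (Fin k) λ i → (SubOfCycle.P (SubCycleCopy.S c) i ≡ true) × (SubCycleCopy.f c i ≡ x)

data Reach {n : ℕ} (R : Vertex n → Set) : Vertex n → Vertex n → Set where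
  here : ∀ {u} → ¬ R u → Reach R u u
  step : ∀ {u w x} → Reach R u w → QAdj w x → ¬ R x → Reach R u x

DisconnectedOrTrivial : ∀ {n} → (Vertex n → Set) → Set
DisconnectedOrTrivial {n} R =
  (Σ (Vertex n) λ u → Σ (Vertex n) λ v → ¬ R u × ¬ R v × ¬ Reach R u v)
  ⊎ (Σ (Vertex n) λ u → ¬ R u × (∀ v → ¬ R v → v ≡ u))

-- A family F of subgraphs is given as a list; its cardinality is the
-- length (duplicates only increase length, so minima agree with sets).

UnionCycle : ∀ {n k} → List (CycleCopy n k) → Vertex n → Set
UnionCycle F x = Σ _ λ c → (c ∈ F) × InCycleCopy c x

UnionSubCycle : ∀ {n k} → List (SubCycleCopy n k) → Vertex n → Set
UnionSubCycle F x = Σ _ λ c → (c ∈ F) × InSubCycleCopy c x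

IsStructureCut : ∀ n k → List (CycleCopy n k) → Set
IsStructureCut n k F = DisconnectedOrTrivial (UnionCycle F)

IsSubstructureCut : ∀ n k → List (SubCycleCopy n k) → Set
IsSubstructureCut n k F = DisconnectedOrTrivial (UnionSubCycle F)

-- ⌈ a / k ⌉ (k = 0 gives 0, irrelevant here)
ceilDiv : ℕ → ℕ → ℕ
ceilDiv a zero    = 0
ceilDiv a (suc k) = (a + k) / suc k

KappaS≡ : ℕ → ℕ → ℕ → Set
KappaS≡ n k m =
  (Σ (List (SubCycleCopy n k)) λ F → IsSubstructureCut n k F × length F ≡ m)
  × (∀ F → IsSubstructureCut n k F → m ≤ length F)

KappaGE : ℕ → ℕ → ℕ → Set
KappaGE n k m = ∀ F → IsStructureCut n k F → m ≤ length F

-- Write k = 2h. A member of a C_k-substructure cut is a connected subgraph of C_k, hence (C_k and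
-- Q_n being bipartite) has at most h vertices of each parity. So m members with m h < n delete at
-- most 2n − 2 vertices and at most n − 1 neighbours of any vertex: nothing is isolated. Splitting
-- Q_n into two copies of Q_{n−1} shows that such a fault set can only disconnect Q_n in the
-- extremal configurations (essentially, the faults are the neighbourhood of an edge), where the
-- faults fall apart into clusters of at most two vertices; but a member lying inside such a
-- cluster leaves too few faults. Hence κ^s ≥ ⌈2n/k⌉, and κ ≥ κ^s as a copy of C_k is itself a
-- substructure. Conversely, ⌈2n/k⌉ paths e_a, e_a + e_{a+1}, e_{a+1}, … cover all neighbours
-- of the zero vector and isolate it.
module Submission where

open import Defs
open import Data.Bool using (Bool; true; false; not; _xor_; _∨_)
open import Data.Bool.Properties using (not-involutive; not-¬; ¬-not; ∨-identityʳ)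
  renaming (_≟_ to _≟ᴮ_)
open import Data.Bool.Properties using (not-distribˡ-xor; not-distribʳ-xor; xor-assoc; xor-same; xor-identityˡ)
open import Data.Empty using (⊥; ⊥-elim)
open import Data.Fin using (Fin; zero; suc; fromℕ<; toℕ) renaming (_≟_ to _≟ᶠ_)
open import Data.Fin.Properties using (toℕ<n; toℕ-injective; toℕ-fromℕ<; fromℕ<-toℕ)
open import Data.List using (List; []; _∷_; length; map; _++_; tabulate; concatMap; filter; allFin)
open import Data.List.Properties using (length-map; length-++; length-tabulate; length-removeAt′; length-filter)
open import Data.List.Membership.Propositional using (_∈_; _∉_; find; lose)
open import Data.List.Membership.Propositional.Properties using (∈-map⁺; ∈-map⁻; ∈-++⁺ˡ; ∈-++⁺ʳ; ∈-++⁻)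
open import Data.List.Membership.Propositional.Properties using (∈-tabulate⁺; ∈-tabulate⁻; ∈-allFin)
open import Data.List.Membership.Propositional.Properties using (∈-concatMap⁺; ∈-concatMap⁻; ∈-filter⁺; ∈-filter⁻)
import Data.List.Membership.DecPropositional as DecMembership
open import Data.List.Relation.Binary.Subset.Propositional using (_⊆_)
open import Data.List.Relation.Unary.All as All using (All; all?)
open import Data.List.Relation.Unary.All.Properties using (¬Any⇒All¬; ¬All⇒Any¬)
open import Data.List.Relation.Unary.Any using (here; there; index; _─_)
open import Data.List.Relation.Unary.Unique.Propositional using (Unique; []; _∷_)
import Data.List.Relation.Unary.Unique.Propositional.Properties as Unique
open import Data.Nat using (ℕ; zero; suc; _+_; _*_; _∸_; _^_; _≤_; _<_; z≤n; s≤s; _≤?_; _<?_; ⌊_/2⌋)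
open import Data.Nat.Divisibility using (_∣_; divides)
open import Data.Nat.DivMod using (_%_; _/_; m<n⇒m%n≡m; n%n≡0; m%n<n; m≡m%n+[m/n]*n)
open import Data.Nat.DivMod using (m/n*n≤m; m*n/n≡m; /-monoˡ-≤)
open import Data.Nat.Properties
open import Algebra.Properties.CommutativeSemigroup +-commutativeSemigroup using (x∙yz≈y∙xz; xy∙z≈x∙zy)
open import Data.Product using (∃; _×_; _,_; proj₁; proj₂)
open import Data.Sum using (_⊎_; inj₁; inj₂; [_,_]′; swap)
open import Data.Vec using ([]; _∷_; lookup; head; tail; replicate) renaming (tabulate to tabulateᵛ)
open import Data.Vec.Properties using (≡-dec; ∷-injectiveʳ; lookup-replicate)
open import Data.Vec.Properties using (lookup∘tabulate; tabulate∘lookup; tabulate-cong)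
open import Function using (_∘_; id; flip)
open import Relation.Binary.PropositionalEquality
open import Relation.Nullary using (¬_; Dec; yes; no; does; _⊎-dec_; _×-dec_)
open import Relation.Nullary.Decidable using (dec-true; dec-false)
open import Relation.Unary using (Decidable)

module _ {A : Set} where

  ∈-─ : ∀ {x y : A} {ys} (x∈ys : x ∈ ys) → y ∈ ys → y ≢ x → y ∈ (ys ─ x∈ys)
  ∈-─ (here refl)  (here refl)  y≢x = ⊥-elim (y≢x refl)
  ∈-─ (here refl)  (there y∈ys) _   = y∈ys
  ∈-─ (there _)    (here refl)  _   = here refl
  ∈-─ (there x∈ys) (there y∈ys) y≢x = there (∈-─ x∈ys y∈ys y≢x)

  pigeonhole : ∀ {xs ys : List A} → Unique xs → xs ⊆ ys → length xs ≤ length ys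
  pigeonhole [] _ = z≤n
  pigeonhole {x ∷ xs} {ys} (x≢xs ∷ unique) xs⊆ys = begin
    suc (length xs)          ≤⟨ s≤s (pigeonhole unique (λ y∈xs →
                                  ∈-─ x∈ys (xs⊆ys (there y∈xs)) (All.lookup x≢xs y∈xs ∘ sym))) ⟩
    suc (length (ys ─ x∈ys)) ≡⟨ sym (length-removeAt′ ys (index x∈ys)) ⟩
    length ys                ∎
    where
    open ≤-Reasoning
    x∈ys : x ∈ ys
    x∈ys = xs⊆ys (here refl)

  all⊎counterexample : ∀ {P : A → Set} → Decidable P → ∀ xs → All P xs ⊎ ∃ λ x → x ∈ xs × ¬ P x
  all⊎counterexample P? xs with all? P? xs
  ... | yes all = inj₁ all
  ... | no ¬all = inj₂ (find (¬All⇒Any¬ P? xs ¬all))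

  ∃∈ : ∀ {xs : List A} → 1 ≤ length xs → ∃ (_∈ xs)
  ∃∈ {x ∷ _} _ = x , here refl

  length-concatMap-≤ : ∀ {B : Set} (f : A → List B) {k} → (∀ a → length (f a) ≤ k) →
                       ∀ as → length (concatMap f as) ≤ length as * k
  length-concatMap-≤ f bound []       = z≤n
  length-concatMap-≤ f bound (a ∷ as) =
    subst (_≤ _) (sym (length-++ (f a))) (+-mono-≤ (bound a) (length-concatMap-≤ f bound as))

  does⇒ : (d : Dec A) → does d ≡ true → A
  does⇒ (yes a) _ = a

∨≡true⇒ : ∀ a {b} → a ∨ b ≡ true → a ≡ true ⊎ b ≡ true
∨≡true⇒ true  _   = inj₁ refl
∨≡true⇒ false b≡ = inj₂ b≡

≡not⇒≡not : ∀ {a b} → a ≡ not b → b ≡ not a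
≡not⇒≡not {b = b} refl = sym (not-involutive b)

toggle : ∀ {n} → Fin n → Vertex n → Vertex n
toggle zero    (b ∷ u) = not b ∷ u
toggle (suc i) (b ∷ u) = b ∷ toggle i u

parity : ∀ {n} → Vertex n → Bool
parity []      = false
parity (b ∷ u) = b xor parity u

_≟ᵛ_ : ∀ {n} (u v : Vertex n) → Dec (u ≡ v)
_≟ᵛ_ = ≡-dec _≟ᴮ_

parity-toggle : ∀ {n} (i : Fin n) u → parity (toggle i u) ≡ not (parity u)
parity-toggle zero    (b ∷ u) = sym (not-distribˡ-xor b (parity u))
parity-toggle (suc i) (b ∷ u) =
  trans (cong (b xor_) (parity-toggle i u)) (sym (not-distribʳ-xor b (parity u)))

lookup-toggle-≡ : ∀ {n} (i : Fin n) u → lookup (toggle i u) i ≡ not (lookup u i)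
lookup-toggle-≡ zero    (b ∷ u) = refl
lookup-toggle-≡ (suc i) (b ∷ u) = lookup-toggle-≡ i u

lookup-toggle-≢ : ∀ {n} {i j : Fin n} u → i ≢ j → lookup (toggle i u) j ≡ lookup u j
lookup-toggle-≢ {i = zero}  {zero}  (b ∷ u) i≢j = ⊥-elim (i≢j refl)
lookup-toggle-≢ {i = zero}  {suc j} (b ∷ u) i≢j = refl
lookup-toggle-≢ {i = suc i} {zero}  (b ∷ u) i≢j = refl
lookup-toggle-≢ {i = suc i} {suc j} (b ∷ u) i≢j = lookup-toggle-≢ u (i≢j ∘ cong suc)

toggle-involutive : ∀ {n} (i : Fin n) u → toggle i (toggle i u) ≡ u
toggle-involutive zero    (b ∷ u) = cong (_∷ u) (not-involutive b)
toggle-involutive (suc i) (b ∷ u) = cong (b ∷_) (toggle-involutive i u)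

toggle-comm : ∀ {n} (i j : Fin n) u → toggle i (toggle j u) ≡ toggle j (toggle i u)
toggle-comm zero    zero    (b ∷ u) = refl
toggle-comm zero    (suc j) (b ∷ u) = refl
toggle-comm (suc i) zero    (b ∷ u) = refl
toggle-comm (suc i) (suc j) (b ∷ u) = cong (b ∷_) (toggle-comm i j u)

toggle-injective : ∀ {n} {i j : Fin n} u → toggle i u ≡ toggle j u → i ≡ j
toggle-injective {i = i} {j} u eq with i ≟ᶠ j
... | yes i≡j = i≡j
... | no i≢j  = ⊥-elim (not-¬ (begin
  lookup (toggle i u) i ≡⟨ cong (λ w → lookup w i) eq ⟩
  lookup (toggle j u) i ≡⟨ lookup-toggle-≢ u (i≢j ∘ sym) ⟩
  lookup u i            ∎) (lookup-toggle-≡ i u))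
  where open ≡-Reasoning

toggle₂≢ : ∀ {n} {i j : Fin n} p → i ≢ j → toggle j (toggle i p) ≢ p
toggle₂≢ {i = i} {j} p i≢j eq = not-¬ refl (begin
  lookup p i                       ≡⟨ cong (λ w → lookup w i) (sym eq) ⟩
  lookup (toggle j (toggle i p)) i ≡⟨ lookup-toggle-≢ (toggle i p) (i≢j ∘ sym) ⟩
  lookup (toggle i p) i            ≡⟨ lookup-toggle-≡ i p ⟩
  not (lookup p i)                 ∎)
  where open ≡-Reasoning

toggle₂-injective : ∀ {n} {a b i j : Fin n} p → i ≢ j →
              toggle b (toggle a p) ≡ toggle j (toggle i p) → a ≡ i ⊎ a ≡ j
toggle₂-injective {a = a} {b} {i} {j} p i≢j eq with a ≟ᶠ i | a ≟ᶠ j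
... | yes a≡i | _       = inj₁ a≡i
... | no _    | yes a≡j = inj₂ a≡j
... | no a≢i  | no a≢j with b ≟ᶠ a
...   | yes refl = ⊥-elim (toggle₂≢ p i≢j (trans (sym eq) (toggle-involutive b p)))
...   | no b≢a   = ⊥-elim (not-¬ refl (begin
  lookup p a                       ≡⟨ sym (lookup-toggle-≢ p (a≢i ∘ sym)) ⟩
  lookup (toggle i p) a            ≡⟨ sym (lookup-toggle-≢ (toggle i p) (a≢j ∘ sym)) ⟩
  lookup (toggle j (toggle i p)) a ≡⟨ cong (λ w → lookup w a) (sym eq) ⟩
  lookup (toggle b (toggle a p)) a ≡⟨ lookup-toggle-≢ (toggle a p) b≢a ⟩
  lookup (toggle a p) a            ≡⟨ lookup-toggle-≡ a p ⟩
  not (lookup p a)                 ∎))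
  where open ≡-Reasoning

diffBit-refl : ∀ b → diffBit b b ≡ 0
diffBit-refl true  = refl
diffBit-refl false = refl

diffBit-not : ∀ b → diffBit b (not b) ≡ 1
diffBit-not true  = refl
diffBit-not false = refl

hamming-refl : ∀ {n} (u : Vertex n) → hamming u u ≡ 0
hamming-refl []      = refl
hamming-refl (b ∷ u) = cong₂ _+_ (diffBit-refl b) (hamming-refl u)

hamming≡0⇒≡ : ∀ {n} (u v : Vertex n) → hamming u v ≡ 0 → u ≡ v
hamming≡0⇒≡ []          []          _  = refl
hamming≡0⇒≡ (true ∷ u)  (true ∷ v)  eq = cong (true ∷_) (hamming≡0⇒≡ u v eq)
hamming≡0⇒≡ (false ∷ u) (false ∷ v) eq = cong (false ∷_) (hamming≡0⇒≡ u v eq)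

QAdj-irrefl : ∀ {n} (u : Vertex n) → ¬ QAdj u u
QAdj-irrefl u adj = 0≢1+n (trans (sym (hamming-refl u)) adj)

QAdj-toggle : ∀ {n} (i : Fin n) u → QAdj u (toggle i u)
QAdj-toggle zero    (b ∷ u) = cong₂ _+_ (diffBit-not b) (hamming-refl u)
QAdj-toggle (suc i) (b ∷ u) = trans (cong (_+ _) (diffBit-refl b)) (QAdj-toggle i u)

QAdj⇒toggle : ∀ {n} (u v : Vertex n) → QAdj u v → ∃ λ i → v ≡ toggle i u
QAdj⇒toggle []          []          ()
QAdj⇒toggle (true ∷ u)  (true ∷ v)  adj = let i , eq = QAdj⇒toggle u v adj in suc i , cong (true ∷_) eq
QAdj⇒toggle (false ∷ u) (false ∷ v) adj = let i , eq = QAdj⇒toggle u v adj in suc i , cong (false ∷_) eq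
QAdj⇒toggle (true ∷ u)  (false ∷ v) adj = zero , cong (false ∷_) (sym (hamming≡0⇒≡ u v (suc-injective adj)))
QAdj⇒toggle (false ∷ u) (true ∷ v)  adj = zero , cong (true ∷_) (sym (hamming≡0⇒≡ u v (suc-injective adj)))

QAdj-sym : ∀ {n} {u v : Vertex n} → QAdj u v → QAdj v u
QAdj-sym {u = u} {v} adj with QAdj⇒toggle u v adj
... | i , refl = subst (QAdj (toggle i u)) (toggle-involutive i u) (QAdj-toggle i (toggle i u))

parity-QAdj : ∀ {n} {u v : Vertex n} → QAdj u v → parity v ≡ not (parity u)
parity-QAdj {u = u} {v} adj with QAdj⇒toggle u v adj
... | i , refl = parity-toggle i u

parity-≡⇒¬QAdj : ∀ {n} {u v : Vertex n} → parity u ≡ parity v → ¬ QAdj u v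
parity-≡⇒¬QAdj {u = u} {v} eq adj = not-¬ (sym eq) (parity-QAdj {u = u} {v} adj)

common-neighbour : ∀ {n} {i j : Fin n} {p w : Vertex n} → i ≢ j →
                   QAdj p w → QAdj w (toggle j (toggle i p)) → w ≡ toggle i p ⊎ w ≡ toggle j p
common-neighbour {p = p} {w} i≢j adj₁ adj₂ with QAdj⇒toggle p w adj₁
... | a , refl with QAdj⇒toggle w _ adj₂
...   | b , eq with toggle₂-injective p i≢j (sym eq)
...     | inj₁ refl = inj₁ refl
...     | inj₂ refl = inj₂ refl

∷-QAdj : ∀ {n} b (x y : Vertex n) → QAdj x y → QAdj (b ∷ x) (b ∷ y)
∷-QAdj b x y adj = trans (cong (_+ _) (diffBit-refl b)) adj

QAdj-across : ∀ {n} b (x : Vertex n) → QAdj (b ∷ x) (not b ∷ x)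
QAdj-across b x = QAdj-toggle zero (b ∷ x)

QAdj-∷⁻ : ∀ {n} {b c} {x y : Vertex n} → QAdj (b ∷ x) (c ∷ y) →
          (c ≡ not b × y ≡ x) ⊎ (c ≡ b × QAdj x y)
QAdj-∷⁻ {b = true}  {true}  adj = inj₂ (refl , adj)
QAdj-∷⁻ {b = false} {false} adj = inj₂ (refl , adj)
QAdj-∷⁻ {b = true}  {false} {x} {y} adj = inj₁ (refl , sym (hamming≡0⇒≡ x y (suc-injective adj)))
QAdj-∷⁻ {b = false} {true}  {x} {y} adj = inj₁ (refl , sym (hamming≡0⇒≡ x y (suc-injective adj)))

_∈ᵛ?_ : ∀ {n} (x : Vertex n) xs → Dec (x ∈ xs)
_∈ᵛ?_ = DecMembership._∈?_ _≟ᵛ_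

pigeonhole-⊇ : ∀ {n} {xs ys : List (Vertex n)} → Unique xs → xs ⊆ ys → length ys ≤ length xs →
               ys ⊆ xs
pigeonhole-⊇ {xs = xs} {ys} unique xs⊆ys ys≤xs {y} y∈ys with y ∈ᵛ? xs
... | yes y∈xs = y∈xs
... | no  y∉xs = ⊥-elim (<⇒≱ (s≤s ys≤xs) (pigeonhole (¬Any⇒All¬ xs y∉xs ∷ unique) λ
  { (here refl) → y∈ys ; (there z∈xs) → xs⊆ys z∈xs }))

QAdj⇒unique : ∀ {n} {x y : Vertex n} → QAdj x y → Unique (x ∷ y ∷ [])
QAdj⇒unique {x = x} {y} adj =
  ((λ x≡y → QAdj-irrefl y (subst (λ z → QAdj z y) x≡y adj)) All.∷ All.[]) ∷ All.[] ∷ []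

neighbours : ∀ {n} → Vertex n → List (Vertex n)
neighbours u = tabulate (λ i → toggle i u)

length-neighbours : ∀ {n} (u : Vertex n) → length (neighbours u) ≡ n
length-neighbours u = length-tabulate (λ i → toggle i u)

neighbours-unique : ∀ {n} (u : Vertex n) → Unique (neighbours u)
neighbours-unique u = Unique.tabulate⁺ (toggle-injective u)

QAdj⇒∈neighbours : ∀ {n} {u w : Vertex n} → QAdj u w → w ∈ neighbours u
QAdj⇒∈neighbours {u = u} {w} adj with QAdj⇒toggle u w adj
... | i , refl = ∈-tabulate⁺ i

∈neighbours⇒QAdj : ∀ {n} {u w : Vertex n} → w ∈ neighbours u → QAdj u w
∈neighbours⇒QAdj {u = u} w∈ with ∈-tabulate⁻ w∈
... | i , refl = QAdj-toggle i u

parity-∈neighbours : ∀ {n} {u w : Vertex n} → w ∈ neighbours u → parity w ≡ not (parity u)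
parity-∈neighbours {u = u} {w} w∈ = parity-QAdj {u = u} {w} (∈neighbours⇒QAdj w∈)

neighbours-disjoint : ∀ {n} {x y w : Vertex n} → QAdj x y → w ∈ neighbours x → w ∉ neighbours y
neighbours-disjoint {x = x} {y} {w} adj w∈x w∈y = not-¬ refl (begin
  parity x             ≡⟨ sym (not-involutive (parity x)) ⟩
  not (not (parity x)) ≡⟨ cong not (sym (parity-QAdj {u = x} {y} adj)) ⟩
  not (parity y)       ≡⟨ sym (parity-∈neighbours w∈y) ⟩
  parity w             ≡⟨ parity-∈neighbours w∈x ⟩
  not (parity x)       ∎)
  where open ≡-Reasoning

stack : ∀ {n} → List (Vertex n) → List (Vertex n) → List (Vertex (suc n))
stack xs ys = map (false ∷_) xs ++ map (true ∷_) ys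

length-stack : ∀ {n} (xs ys : List (Vertex n)) → length (stack xs ys) ≡ length xs + length ys
length-stack xs ys =
  trans (length-++ (map (false ∷_) xs)) (cong₂ _+_ (length-map _ xs) (length-map _ ys))

stack-unique : ∀ {n} {xs ys : List (Vertex n)} → Unique xs → Unique ys → Unique (stack xs ys)
stack-unique {xs = xs} {ys} xs-unique ys-unique =
  Unique.++⁺ (Unique.map⁺ ∷-injectiveʳ xs-unique) (Unique.map⁺ ∷-injectiveʳ ys-unique) disjoint
  where
  disjoint : ∀ {v} → ¬ (v ∈ map (false ∷_) xs × v ∈ map (true ∷_) ys)
  disjoint (v∈₀ , v∈₁) with ∈-map⁻ (false ∷_) v∈₀ | ∈-map⁻ (true ∷_) v∈₁
  ... | _ , _ , refl | _ , _ , ()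

vertices : ∀ n → List (Vertex n)
vertices zero    = [] ∷ []
vertices (suc n) = stack (vertices n) (vertices n)

length-vertices : ∀ n → length (vertices n) ≡ 2 ^ n
length-vertices zero    = refl
length-vertices (suc n) = begin
  length (stack (vertices n) (vertices n))  ≡⟨ length-stack (vertices n) (vertices n) ⟩
  length (vertices n) + length (vertices n) ≡⟨ cong₂ _+_ (length-vertices n) (length-vertices n) ⟩
  2 ^ n + 2 ^ n                             ≡⟨ cong (2 ^ n +_) (sym (+-identityʳ (2 ^ n))) ⟩
  2 ^ suc n                                 ∎
  where open ≡-Reasoning

∈-vertices : ∀ {n} (v : Vertex n) → v ∈ vertices n
∈-vertices []          = here refl
∈-vertices (false ∷ v) = ∈-++⁺ˡ (∈-map⁺ (false ∷_) (∈-vertices v))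
∈-vertices (true ∷ v)  = ∈-++⁺ʳ _ (∈-map⁺ (true ∷_) (∈-vertices v))

vertices-unique : ∀ n → Unique (vertices n)
vertices-unique zero    = All.[] ∷ []
vertices-unique (suc n) = stack-unique (vertices-unique n) (vertices-unique n)

half : ∀ {n} → Bool → List (Vertex (suc n)) → List (Vertex n)
half b     []                = []
half true  ((true  ∷ w) ∷ L) = w ∷ half true L
half true  ((false ∷ w) ∷ L) = half true L
half false ((false ∷ w) ∷ L) = w ∷ half false L
half false ((true  ∷ w) ∷ L) = half false L

half-∈⁺ : ∀ {n} b {w : Vertex n} {L} → (b ∷ w) ∈ L → w ∈ half b L
half-∈⁺ true  {L = (true  ∷ _) ∷ L} (here refl) = here refl
half-∈⁺ false {L = (false ∷ _) ∷ L} (here refl) = here refl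
half-∈⁺ true  {L = (true  ∷ _) ∷ L} (there p) = there (half-∈⁺ true p)
half-∈⁺ true  {L = (false ∷ _) ∷ L} (there p) = half-∈⁺ true p
half-∈⁺ false {L = (false ∷ _) ∷ L} (there p) = there (half-∈⁺ false p)
half-∈⁺ false {L = (true  ∷ _) ∷ L} (there p) = half-∈⁺ false p

half-∈⁻ : ∀ {n} b {w : Vertex n} {L} → w ∈ half b L → (b ∷ w) ∈ L
half-∈⁻ true  {L = (true  ∷ _) ∷ L} (here refl) = here refl
half-∈⁻ false {L = (false ∷ _) ∷ L} (here refl) = here refl
half-∈⁻ true  {L = (true  ∷ _) ∷ L} (there p) = there (half-∈⁻ true p)
half-∈⁻ true  {L = (false ∷ _) ∷ L} p = there (half-∈⁻ true p)
half-∈⁻ false {L = (false ∷ _) ∷ L} (there p) = there (half-∈⁻ false p)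
half-∈⁻ false {L = (true  ∷ _) ∷ L} p = there (half-∈⁻ false p)

length-halves : ∀ {n} (L : List (Vertex (suc n))) →
                length (half false L) + length (half true L) ≡ length L
length-halves [] = refl
length-halves ((true  ∷ _) ∷ L) = trans (+-suc (length (half false L)) _) (cong suc (length-halves L))
length-halves ((false ∷ _) ∷ L) = cong suc (length-halves L)

length-half+half : ∀ {n} b (L : List (Vertex (suc n))) →
                   length (half b L) + length (half (not b) L) ≡ length L
length-half+half false L = length-halves L
length-half+half true  L = trans (+-comm (length (half true L)) _) (length-halves L)

module _ {n} {R : Vertex n → Set} where

  Reach-free : ∀ {u v} → Reach R u v → ¬ R v
  Reach-free (here ¬Ru)     = ¬Ru
  Reach-free (step _ _ ¬Rx) = ¬Rx

  Reach-edge : ∀ {u v} → ¬ R u → QAdj u v → ¬ R v → Reach R u v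
  Reach-edge ¬Ru adj ¬Rv = step (here ¬Ru) adj ¬Rv

  Reach-trans : ∀ {u v w} → Reach R u v → Reach R v w → Reach R u w
  Reach-trans r (here _)          = r
  Reach-trans r (step r′ adj ¬Rx) = step (Reach-trans r r′) adj ¬Rx

  Reach-sym : ∀ {u v} → Reach R u v → Reach R v u
  Reach-sym (here ¬Ru) = here ¬Ru
  Reach-sym (step {w = w} {x} r adj ¬Rx) =
    Reach-trans (Reach-edge ¬Rx (QAdj-sym {u = w} {x} adj) (Reach-free r)) (Reach-sym r)

  Reach-anti : ∀ {R′ : Vertex n → Set} → (∀ {x} → R x → R′ x) →
               ∀ {u v} → Reach R′ u v → Reach R u v
  Reach-anti R⊆R′ (here ¬Ru)       = here (¬Ru ∘ R⊆R′)
  Reach-anti R⊆R′ (step r adj ¬Rx) = step (Reach-anti R⊆R′ r) adj (¬Rx ∘ R⊆R′)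

Linked : ∀ {n} → List (Vertex n) → Vertex n → Vertex n → Set
Linked L = Reach (_∈ L)

Connected : ∀ {n} → List (Vertex n) → Set
Connected {n} L = ∀ (u v : Vertex n) → u ∉ L → v ∉ L → Linked L u v

HasFreeNeighbour : ∀ {n} → List (Vertex n) → Vertex n → Set
HasFreeNeighbour L u = ∃ λ w → QAdj u w × w ∉ L

ConnectedBeyondIsolated : ∀ {n} → List (Vertex n) → Set
ConnectedBeyondIsolated {n} L = ∀ (u v : Vertex n) → u ∉ L → v ∉ L →
  HasFreeNeighbour L u → HasFreeNeighbour L v → Linked L u v

Linked-lift : ∀ {n} b {L : List (Vertex (suc n))} {x y} →
              Linked (half b L) x y → Linked L (b ∷ x) (b ∷ y)
Linked-lift b (here x∉)                   = here (x∉ ∘ half-∈⁺ b)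
Linked-lift b (step {w = w} {x} r adj x∉) = step (Linked-lift b r) (∷-QAdj b w x adj) (x∉ ∘ half-∈⁺ b)

free-neighbour : ∀ {n} (L M : List (Vertex n)) u →
                 (∀ {w} → QAdj u w → w ∈ L → w ∈ M) → length M < n → HasFreeNeighbour L u
free-neighbour L M u faulty⊆M M<n with all⊎counterexample (_∈ᵛ? L) (neighbours u)
... | inj₂ (w , w∈ , w∉L) = w , ∈neighbours⇒QAdj w∈ , w∉L
... | inj₁ all∈L = ⊥-elim (<⇒≱ M<n (subst (_≤ length M) (length-neighbours u)
  (pigeonhole (neighbours-unique u) (λ w∈ → faulty⊆M (∈neighbours⇒QAdj w∈) (All.lookup all∈L w∈)))))

free-neighbour-if-few : ∀ {n} (L : List (Vertex n)) → length L < n → ∀ u → HasFreeNeighbour L u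
free-neighbour-if-few L L<n u = free-neighbour L L u (λ _ w∈L → w∈L) L<n

-- At most n faults

Q₁-connected : (L : List (Vertex 1)) → Connected L
Q₁-connected L (a ∷ []) (b ∷ []) a∉ b∉ with a ≟ᴮ b
... | yes refl = here a∉
... | no a≢b  =
  Reach-edge a∉ (subst (λ c → QAdj (a ∷ []) (c ∷ [])) (sym (¬-not (a≢b ∘ sym))) (QAdj-across a [])) b∉

Escape : ∀ {n} → List (Vertex (suc n)) → Bool → Vertex n → Set
Escape L c x = ∃ λ z → (not c ∷ z) ∉ L × Linked L (c ∷ x) (not c ∷ z)

Escapes : ∀ {n} → List (Vertex (suc n)) → Bool → Set
Escapes {n} L c = ∀ (x : Vertex n) → (c ∷ x) ∉ L → HasFreeNeighbour L (c ∷ x) → Escape L c x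

connected-via-half : ∀ {n} {L : List (Vertex (suc n))} c →
                     Connected (half (not c) L) → Escapes L c → ConnectedBeyondIsolated L
connected-via-half {L = L} c conn escapes u v u∉ v∉ u↑ v↑ =
  let zu , zu∉ , u⇝zu = toHalf u u∉ u↑
      zv , zv∉ , v⇝zv = toHalf v v∉ v↑
      zu⇝zv = Linked-lift (not c) (conn zu zv (zu∉ ∘ half-∈⁻ (not c)) (zv∉ ∘ half-∈⁻ (not c)))
  in Reach-trans (Reach-trans u⇝zu zu⇝zv) (Reach-sym v⇝zv)
  where
  toHalf : ∀ u → u ∉ L → HasFreeNeighbour L u → ∃ λ z → (not c ∷ z) ∉ L × Linked L u (not c ∷ z)
  toHalf (d ∷ x) u∉ u↑ with d ≟ᴮ not c
  ... | yes refl = x , u∉ , here u∉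
  ... | no d≢ with trans (¬-not d≢) (not-involutive c)
  ...   | refl = escapes x u∉ u↑

escape-or-blocked : ∀ {n} {L : List (Vertex (suc n))} c x → (c ∷ x) ∉ L → HasFreeNeighbour L (c ∷ x) →
  Escape L c x ⊎ ∃ λ y → QAdj x y × (c ∷ y) ∉ L × (not c ∷ x) ∈ L × (not c ∷ y) ∈ L
escape-or-blocked {L = L} c x u∉ (d ∷ y , adj , v∉)
  with (not c ∷ x) ∈ᵛ? L | QAdj-∷⁻ {b = c} {d} {x} {y} adj
... | no  x′∉ | _                  = inj₁ (x , x′∉ , Reach-edge u∉ (QAdj-across c x) x′∉)
... | yes x′∈ | inj₁ (refl , refl) = ⊥-elim (v∉ x′∈)
... | yes x′∈ | inj₂ (refl , x~y) with (not c ∷ y) ∈ᵛ? L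
...   | no  y′∉ = inj₁ (y , y′∉ , step (Reach-edge u∉ adj v∉) (QAdj-across c y) y′∉)
...   | yes y′∈ = inj₂ (y , x~y , v∉ , x′∈ , y′∈)

escape-via-free-column : ∀ {n} {L : List (Vertex (suc n))} c {w} → (c ∷ w) ∉ L → (not c ∷ w) ∉ L →
                         Connected (half c L) → Escapes L c
escape-via-free-column c {w} w∉ w′∉ conn x u∉ _ =
  w , w′∉ , step (Linked-lift c (conn x w (u∉ ∘ half-∈⁻ c) (w∉ ∘ half-∈⁻ c)))
                 (QAdj-across c w) w′∉

escape-past-sparse-half : ∀ {n} {L : List (Vertex (suc n))} c → length (half (not c) L) ≤ 1 → Escapes L c
escape-past-sparse-half c sparse x u∉ u↑ with escape-or-blocked c x u∉ u↑
... | inj₁ escape = escape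
... | inj₂ (y , x~y , _ , x′∈ , y′∈) = ⊥-elim (<⇒≱ (s≤s sparse) (pigeonhole (QAdj⇒unique x~y)
  λ { (here refl) → half-∈⁺ (not c) x′∈ ; (there (here refl)) → half-∈⁺ (not c) y′∈ }))

free-column : ∀ {n} (L : List (Vertex (suc n))) → length L < 2 ^ n →
              ∃ λ w → (false ∷ w) ∉ L × (true ∷ w) ∉ L
free-column {n} L L<2ⁿ
  with all⊎counterexample (λ w → ((false ∷ w) ∈ᵛ? L) ⊎-dec ((true ∷ w) ∈ᵛ? L)) (vertices n)
... | inj₂ (w , _ , w∉) = w , w∉ ∘ inj₁ , w∉ ∘ inj₂
... | inj₁ all∈ = ⊥-elim (<⇒≱ L<2ⁿ (begin
  2 ^ n                ≡⟨ sym (length-vertices n) ⟩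
  length (vertices n)  ≤⟨ pigeonhole (vertices-unique n) (λ w∈ → tail∈ (All.lookup all∈ w∈)) ⟩
  length (map tail L)  ≡⟨ length-map tail L ⟩
  length L             ∎))
  where
  open ≤-Reasoning
  tail∈ : ∀ {w} → (false ∷ w) ∈ L ⊎ (true ∷ w) ∈ L → w ∈ map tail L
  tail∈ (inj₁ w∈) = ∈-map⁺ tail w∈
  tail∈ (inj₂ w∈) = ∈-map⁺ tail w∈

2*n≤2^n : ∀ n → 1 ≤ n → 2 * n ≤ 2 ^ n
2*n≤2^n (suc zero)    _ = s≤s (s≤s z≤n)
2*n≤2^n (suc (suc n)) _ = begin
  2 * suc (suc n)       ≡⟨ *-distribˡ-+ 2 1 (suc n) ⟩
  2 + 2 * suc n         ≤⟨ +-mono-≤ (^-monoʳ-≤ 2 {1} {suc n} (s≤s z≤n)) (2*n≤2^n (suc n) (s≤s z≤n)) ⟩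
  2 ^ suc n + 2 ^ suc n ≡⟨ cong (2 ^ suc n +_) (sym (+-identityʳ (2 ^ suc n))) ⟩
  2 ^ suc (suc n)       ∎
  where open ≤-Reasoning

FewFaultsConnected : ℕ → Set
FewFaultsConnected n = ∀ (L : List (Vertex n)) → length L ≤ n → ConnectedBeyondIsolated L

connected-if-length<dim : ∀ {n} → FewFaultsConnected n → (L : List (Vertex n)) →
                          length L < n → Connected L
connected-if-length<dim few L L<n u v u∉ v∉ =
  few L (<⇒≤ L<n) u v u∉ v∉ (free-neighbour-if-few L L<n u) (free-neighbour-if-few L L<n v)

sparse-connected : ∀ n → FewFaultsConnected (suc n) → (L : List (Vertex (suc n))) →
                   length L ≤ 1 → Connected L
sparse-connected zero    _   L _   = Q₁-connected L
sparse-connected (suc n) few L L≤1 = connected-if-length<dim few L (s≤s (≤-trans L≤1 (s≤s z≤n)))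

dense-half-connected : ∀ n → FewFaultsConnected (suc n) → ∀ (L : List (Vertex (suc (suc n)))) →
                       length L ≤ suc (suc n) → ∀ b → suc n ≤ length (half b L) → ConnectedBeyondIsolated L
dense-half-connected n few L L≤ b dense =
  connected-via-half b (sparse-connected n few (half (not b) L) sparse) (escape-past-sparse-half b sparse)
  where
  open ≤-Reasoning
  sparse : length (half (not b) L) ≤ 1
  sparse = +-cancelˡ-≤ (suc n) _ _ (begin
    suc n + length (half (not b) L)             ≤⟨ +-monoˡ-≤ _ dense ⟩
    length (half b L) + length (half (not b) L) ≡⟨ length-half+half b L ⟩
    length L                                    ≤⟨ L≤ ⟩
    suc (suc n)                                 ≡⟨ +-comm 1 (suc n) ⟩
    suc n + 1                                   ∎)

-- If both halves carry fewer faults than their dimension, both are connected and a column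
-- with both ends free joins them; otherwise the other half carries at most one fault.
few-faults-step : ∀ n → FewFaultsConnected (suc n) → FewFaultsConnected (suc (suc n))
few-faults-step n few L L≤ with length (half false L) <? suc n | length (half true L) <? suc n
... | no L₀≮   | _        = dense-half-connected n few L L≤ false (≮⇒≥ L₀≮)
... | yes _    | no L₁≮   = dense-half-connected n few L L≤ true (≮⇒≥ L₁≮)
... | yes L₀<  | yes L₁<  =
  let _ , w₀∉ , w₁∉ = free-column L L<2ⁿ in
  connected-via-half true (connected-if-length<dim few (half false L) L₀<)
    (escape-via-free-column true w₁∉ w₀∉ (connected-if-length<dim few (half true L) L₁<))
  where
  open ≤-Reasoning
  L<2ⁿ : length L < 2 ^ suc n
  L<2ⁿ = begin-strict
    length L                                     ≡⟨ sym (length-halves L) ⟩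
    length (half false L) + length (half true L) <⟨ +-mono-<-≤ L₀< (<⇒≤ L₁<) ⟩
    suc n + suc n                                ≡⟨ cong (suc n +_) (sym (+-identityʳ (suc n))) ⟩
    2 * suc n                                    ≤⟨ 2*n≤2^n (suc n) (s≤s z≤n) ⟩
    2 ^ suc n                                    ∎

few-faults-connected : ∀ n → FewFaultsConnected n
few-faults-connected zero          L _ [] [] u∉ _ _ _ = here u∉
few-faults-connected (suc zero)    L _ u v u∉ v∉ _ _  = Q₁-connected L u v u∉ v∉
few-faults-connected (suc (suc n)) = few-faults-step n (few-faults-connected (suc n))

-- At most 2n − 2 faults

Isolated : ∀ {n} → List (Vertex n) → Vertex n → Set
Isolated L w = w ∉ L × neighbours w ⊆ L

hasFreeNeighbour? : ∀ {n} (L : List (Vertex n)) u → Dec (HasFreeNeighbour L u)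
hasFreeNeighbour? L u with all⊎counterexample (_∈ᵛ? L) (neighbours u)
... | inj₂ (w , w∈ , w∉) = yes (w , ∈neighbours⇒QAdj w∈ , w∉)
... | inj₁ all∈ = no λ (w , adj , w∉) → w∉ (All.lookup all∈ (QAdj⇒∈neighbours adj))

isolated-or-not : ∀ {n} (L : List (Vertex n)) →
                  (∀ w → w ∉ L → HasFreeNeighbour L w) ⊎ ∃ (Isolated L)
isolated-or-not {n} L
  with all⊎counterexample (λ w → (w ∈ᵛ? L) ⊎-dec hasFreeNeighbour? L w) (vertices n)
... | inj₁ all =
  inj₁ λ w w∉ → [ (λ w∈ → ⊥-elim (w∉ w∈)) , id ]′ (All.lookup all (∈-vertices w))
... | inj₂ (w , _ , ¬ok) = inj₂ (w , ¬ok ∘ inj₁ , faulty)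
  where
  faulty : neighbours w ⊆ L
  faulty {w′} w′∈ with w′ ∈ᵛ? L
  ... | yes w′∈L = w′∈L
  ... | no  w′∉L = ⊥-elim (¬ok (inj₂ (w′ , ∈neighbours⇒QAdj w′∈ , w′∉L)))

isolated⇒dim≤length : ∀ {n} {L : List (Vertex n)} {w} → Isolated L w → n ≤ length L
isolated⇒dim≤length {w = w} (_ , N⊆L) =
  subst (_≤ _) (length-neighbours w) (pigeonhole (neighbours-unique w) N⊆L)

isolated⇒⊆neighbours : ∀ {n} {L : List (Vertex n)} {w} → Isolated L w → length L ≤ n → L ⊆ neighbours w
isolated⇒⊆neighbours {w = w} (_ , N⊆L) L≤n =
  pigeonhole-⊇ (neighbours-unique w) N⊆L (subst (_ ≤_) (sym (length-neighbours w)) L≤n)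

ClosedIn : ∀ {n} → List (Vertex n) → List (Vertex n) → Set
ClosedIn L Z = ∀ {z w} → z ∈ Z → z ∈ L → QAdj z w → w ∈ L → w ∈ Z

-- The extremal fault sets of Q_{n+1} (such as the 2n vertices adjacent to an edge) consist of
-- clusters of at most two faults; this hypothesis is what rules them out.
SmallClusterShrinks : ∀ {n} → ℕ → List (Vertex n) → Set
SmallClusterShrinks {n} B L = ∀ (Z : List (Vertex n)) → length Z ≤ 2 → (∃ λ z → z ∈ Z × z ∈ L) →
  ClosedIn L Z → ∃ λ L′ → L ⊆ L′ × length L′ < B

lone-faulty-neighbour : ∀ {n} {L : List (Vertex (suc n))} c {a a′ : Vertex n} {j} → a′ ≡ toggle j a →
  (c ∷ a) ∉ L → (c ∷ a′) ∉ L →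
  (∀ {w} → (c ∷ w) ∈ L → w ∈ neighbours a ⊎ w ∈ neighbours a′) →
  (∀ {w} → (c ∷ w) ∈ L → (not c ∷ w) ∈ L → ⊥) →
  ∀ {w w′} → w ∈ neighbours a → (c ∷ w) ∈ L → QAdj (c ∷ w) w′ → w′ ∈ L → w′ ≡ c ∷ toggle j w
lone-faulty-neighbour {L = L} c {a} {a′} {j} refl a∉ a′∉ faulty⊆ noDouble {w} {d ∷ w₂}
                      w∈ w∈L adj w′∈L with QAdj-∷⁻ {b = c} {d} {w} {w₂} adj
... | inj₁ (refl , refl) = ⊥-elim (noDouble w∈L w′∈L)
... | inj₂ (refl , w~w₂) with faulty⊆ w′∈L
...   | inj₁ w₂∈ = ⊥-elim (parity-≡⇒¬QAdj {u = w} {w₂}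
                      (trans (parity-∈neighbours w∈) (sym (parity-∈neighbours w₂∈))) w~w₂)
...   | inj₂ w₂∈ with ∈-tabulate⁻ w∈
...     | i , refl with i ≟ᶠ j
...       | yes refl = ⊥-elim (a′∉ w∈L)
...       | no i≢j with common-neighbour {i = j} {i} {a′} {w₂} (i≢j ∘ sym) (∈neighbours⇒QAdj w₂∈)
                        (subst (QAdj w₂) (cong (toggle i) (sym (toggle-involutive j a)))
                               (QAdj-sym {u = toggle i a} {w₂} w~w₂))
...         | inj₁ refl = ⊥-elim (a∉ (subst (λ t → (c ∷ t) ∈ L) (toggle-involutive j a) w′∈L))
...         | inj₂ refl = cong (c ∷_) (toggle-comm i j a)

module TightFaults {N} (N≥1 : 1 ≤ N) {L : List (Vertex (suc N))} (L≤ : length L ≤ N + N)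
                   (noIsolated : ∀ u → HasFreeNeighbour L u) (shrinks : SmallClusterShrinks (N + N) L) where

  no-small-cluster : (∀ {L′} → L ⊆ L′ → N + N ≤ length L′) →
                     ∀ z₁ z₂ → z₁ ∈ L → ClosedIn L (z₁ ∷ z₂ ∷ []) → ⊥
  no-small-cluster big z₁ z₂ z₁∈ closed =
    let _ , L⊆L′ , L′< = shrinks (z₁ ∷ z₂ ∷ []) (s≤s (s≤s z≤n)) (z₁ , here refl , z₁∈) closed
    in <⇒≱ L′< (big L⊆L′)

  -- If every column over N(x) ∪ N(y) meets L, these 2N columns hold all of L, one fault each,
  -- and the faults of half c pair up into clusters {c ∷ w, c ∷ toggle j w}, where y = toggle j x.
  module Blocked (c : Bool) {x y : Vertex N} (x~y : QAdj x y) (x∉ : (c ∷ x) ∉ L) (y∉ : (c ∷ y) ∉ L)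
    (sparse : length (half (not c) L) ≤ N)
    (blocked : ∀ {w} → w ∈ neighbours x ++ neighbours y → (c ∷ w) ∈ L ⊎ (not c ∷ w) ∈ L) where

    D : List (Vertex N)
    D = neighbours x ++ neighbours y

    D-unique : Unique D
    D-unique = Unique.++⁺ (neighbours-unique x) (neighbours-unique y)
                          (λ (w∈x , w∈y) → neighbours-disjoint {x = x} {y} x~y w∈x w∈y)

    length-D : length D ≡ N + N
    length-D = trans (length-++ (neighbours x)) (cong₂ _+_ (length-neighbours x) (length-neighbours y))

    D⊆tails : ∀ {L′} → L ⊆ L′ → D ⊆ map tail L′
    D⊆tails L⊆L′ w∈ = [ ∈-map⁺ tail ∘ L⊆L′ , ∈-map⁺ tail ∘ L⊆L′ ]′ (blocked w∈)

    covers-D : ∀ {L′} → L ⊆ L′ → N + N ≤ length L′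
    covers-D {L′} L⊆L′ = subst₂ _≤_ length-D (length-map tail L′) (pigeonhole D-unique (D⊆tails L⊆L′))

    tail∈D : ∀ {e} → e ∈ L → tail e ∈ D
    tail∈D {e} e∈ with tail e ∈ᵛ? D
    ... | yes t∈ = t∈
    ... | no  t∉ = ⊥-elim (<⇒≱ (s≤s L≤) (subst₂ _≤_ (cong suc length-D) (length-map tail L)
      (pigeonhole (¬Any⇒All¬ D t∉ ∷ D-unique)
        λ { (here refl) → ∈-map⁺ tail e∈ ; (there w∈) → D⊆tails id w∈ })))

    no-double : ∀ {w} → (c ∷ w) ∈ L → (not c ∷ w) ∈ L → ⊥
    no-double {w} w∈ w′∈ = <⇒≱ (≤-trans (≤-reflexive (sym (length-removeAt′ L (index w∈)))) L≤)
      (subst₂ _≤_ length-D (length-map tail (L ─ w∈)) (pigeonhole D-unique (survives ∘ blocked)))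
      where
      across≢ : ∀ {v} → (not c ∷ v) ≢ (c ∷ w)
      across≢ eq = not-¬ refl (sym (cong head eq))
      survives : ∀ {v} → (c ∷ v) ∈ L ⊎ (not c ∷ v) ∈ L → v ∈ map tail (L ─ w∈)
      survives (inj₂ v′∈) = ∈-map⁺ tail (∈-─ w∈ v′∈ across≢)
      survives {v} (inj₁ v∈) with v ≟ᵛ w
      ... | yes refl = ∈-map⁺ tail (∈-─ w∈ w′∈ across≢)
      ... | no  v≢w  = ∈-map⁺ tail (∈-─ w∈ v∈ (v≢w ∘ ∷-injectiveʳ))

    dense : N ≤ length (half c L)
    dense = +-cancelʳ-≤ N _ _ (begin
      N + N                                       ≤⟨ covers-D id ⟩
      length L                                    ≡⟨ sym (length-half+half c L) ⟩
      length (half c L) + length (half (not c) L) ≤⟨ +-monoʳ-≤ (length (half c L)) sparse ⟩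
      length (half c L) + N                       ∎)
      where open ≤-Reasoning

    faulty⊆ : ∀ {w} → (c ∷ w) ∈ L → w ∈ neighbours x ⊎ w ∈ neighbours y
    faulty⊆ w∈ = ∈-++⁻ (neighbours x) (tail∈D w∈)

    cluster : ∀ {a a′} → QAdj a a′ → (c ∷ a) ∉ L → (c ∷ a′) ∉ L →
              (∀ {w} → (c ∷ w) ∈ L → w ∈ neighbours a ⊎ w ∈ neighbours a′) →
              ∀ {w₀} → (c ∷ w₀) ∈ L → w₀ ∈ neighbours a → ⊥
    cluster {a} {a′} a~a′ a∉ a′∉ faulty⊆′ {w₀} w₀∈L w₀∈ with QAdj⇒toggle a a′ a~a′
    ... | j , refl = no-small-cluster covers-D (c ∷ w₀) (c ∷ toggle j w₀) w₀∈L closed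
      where
      w₁∈ : toggle j w₀ ∈ neighbours (toggle j a)
      w₁∈ with ∈-tabulate⁻ w₀∈
      ... | i , refl = subst (_∈ neighbours (toggle j a)) (toggle-comm i j a) (∈-tabulate⁺ i)
      closed : ClosedIn L ((c ∷ w₀) ∷ (c ∷ toggle j w₀) ∷ [])
      closed (here refl) z∈ adj w∈ =
        there (here (lone-faulty-neighbour c refl a∉ a′∉ faulty⊆′ no-double w₀∈ z∈ adj w∈))
      closed (there (here refl)) z∈ adj w∈ = here (trans
        (lone-faulty-neighbour c (sym (toggle-involutive j a)) a′∉ a∉ (swap ∘ faulty⊆′) no-double
                               w₁∈ z∈ adj w∈)
        (cong (c ∷_) (toggle-involutive j w₀)))

    blocked⇒⊥ : ⊥
    blocked⇒⊥ with ∃∈ (≤-trans N≥1 dense)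
    ... | w₀ , w₀∈ with faulty⊆ (half-∈⁻ c w₀∈)
    ...   | inj₁ w₀∈x = cluster x~y x∉ y∉ faulty⊆ (half-∈⁻ c w₀∈) w₀∈x
    ...   | inj₂ w₀∈y =
      cluster (QAdj-sym {u = x} {y} x~y) y∉ x∉ (swap ∘ faulty⊆) (half-∈⁻ c w₀∈) w₀∈y

  escape-tight : ∀ c → length (half (not c) L) ≤ N → Escapes L c
  escape-tight c sparse x x∉ x↑ with escape-or-blocked c x x∉ x↑
  ... | inj₁ escape = escape
  ... | inj₂ (y , x~y , y∉ , _ , _)
    with all⊎counterexample (λ w → ((c ∷ w) ∈ᵛ? L) ⊎-dec ((not c ∷ w) ∈ᵛ? L))
                            (neighbours x ++ neighbours y)
  ...   | inj₁ all = ⊥-elim (Blocked.blocked⇒⊥ c x~y x∉ y∉ sparse (All.lookup all))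
  ...   | inj₂ (w , w∈ , free) with ∈-++⁻ (neighbours x) w∈
  ...     | inj₁ w∈x = w , free ∘ inj₂ ,
    step (Reach-edge x∉ (∷-QAdj c x w (∈neighbours⇒QAdj w∈x)) (free ∘ inj₁))
         (QAdj-across c w) (free ∘ inj₂)
  ...     | inj₂ w∈y = w , free ∘ inj₂ ,
    step (step (Reach-edge x∉ (∷-QAdj c x y x~y) y∉)
               (∷-QAdj c y w (∈neighbours⇒QAdj w∈y)) (free ∘ inj₁))
         (QAdj-across c w) (free ∘ inj₂)

  connected-if-good-half : ∀ c → length (half (not c) L) ≤ N →
                           (∀ w → w ∉ half (not c) L → HasFreeNeighbour (half (not c) L) w) → Connected L
  connected-if-good-half c sparse good u v u∉ v∉ =
    connected-via-half c half-connected (escape-tight c sparse) u v u∉ v∉ (noIsolated u) (noIsolated v)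
    where
    half-connected : Connected (half (not c) L)
    half-connected u′ v′ u′∉ v′∉ =
      few-faults-connected N (half (not c) L) sparse u′ v′ u′∉ v′∉ (good u′ u′∉) (good v′ v′∉)

  -- Each half is then exactly the neighbourhood of its isolated vertex, so {false ∷ v, true ∷ v}
  -- is a cluster.
  both-isolated⇒⊥ : ∀ {w₀ w₁} → Isolated (half false L) w₀ → Isolated (half true L) w₁ →
                    length (half false L) ≤ N → length (half true L) ≤ N → ⊥
  both-isolated⇒⊥ {w₀} {w₁} iso₀@(_ , N₀⊆) iso₁@(_ , N₁⊆) L₀≤ L₁≤ =
    no-small-cluster covers (false ∷ v) (true ∷ v) (half-∈⁻ false (N₀⊆ (∈-tabulate⁺ i₀))) closed
    where
    i₀ : Fin N
    i₀ = fromℕ< N≥1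
    v : Vertex N
    v = toggle i₀ w₀
    centre : Bool → Vertex N
    centre false = w₀
    centre true  = w₁
    half⊆ : ∀ c → half c L ⊆ neighbours (centre c)
    half⊆ false = isolated⇒⊆neighbours iso₀ L₀≤
    half⊆ true  = isolated⇒⊆neighbours iso₁ L₁≤
    closed-at : ∀ c {w′} → (c ∷ v) ∈ L → QAdj (c ∷ v) w′ → w′ ∈ L →
                w′ ∈ (false ∷ v) ∷ (true ∷ v) ∷ []
    closed-at c {d ∷ w₂} v∈ adj w′∈ with QAdj-∷⁻ {b = c} {d} {v} {w₂} adj
    closed-at false _ _ _ | inj₁ (refl , refl) = there (here refl)
    closed-at true  _ _ _ | inj₁ (refl , refl) = here refl
    ... | inj₂ (refl , v~w₂) = ⊥-elim (parity-≡⇒¬QAdj {u = v} {w₂}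
      (trans (parity-∈neighbours (half⊆ c (half-∈⁺ c v∈)))
             (sym (parity-∈neighbours (half⊆ c (half-∈⁺ c w′∈))))) v~w₂)
    closed : ClosedIn L ((false ∷ v) ∷ (true ∷ v) ∷ [])
    closed (here refl)         = closed-at false
    closed (there (here refl)) = closed-at true
    E⊆L : stack (neighbours w₀) (neighbours w₁) ⊆ L
    E⊆L e∈ with ∈-++⁻ (map (false ∷_) (neighbours w₀)) e∈
    ... | inj₁ e∈₀ = let _ , t∈ , eq = ∈-map⁻ (false ∷_) e∈₀ in
                     subst (_∈ L) (sym eq) (half-∈⁻ false (N₀⊆ t∈))
    ... | inj₂ e∈₁ = let _ , t∈ , eq = ∈-map⁻ (true ∷_) e∈₁ in
                     subst (_∈ L) (sym eq) (half-∈⁻ true (N₁⊆ t∈))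
    covers : ∀ {L′} → L ⊆ L′ → N + N ≤ length L′
    covers L⊆L′ = subst (_≤ _) (trans (length-stack (neighbours w₀) (neighbours w₁))
                                      (cong₂ _+_ (length-neighbours w₀) (length-neighbours w₁)))
      (pigeonhole (stack-unique (neighbours-unique w₀) (neighbours-unique w₁)) (L⊆L′ ∘ E⊆L))

  other-half-≤ : ∀ b → N ≤ length (half b L) → length (half (not b) L) ≤ N
  other-half-≤ b dense = +-cancelˡ-≤ N _ _ (begin
    N + length (half (not b) L)                 ≤⟨ +-monoˡ-≤ _ dense ⟩
    length (half b L) + length (half (not b) L) ≡⟨ length-half+half b L ⟩
    length L                                    ≤⟨ L≤ ⟩
    N + N                                       ∎)
    where open ≤-Reasoning

  other-half-< : ∀ b → N < length (half b L) → length (half (not b) L) < N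
  other-half-< b dense = +-cancelˡ-< N _ _ (begin-strict
    N + length (half (not b) L)                 <⟨ +-monoˡ-< _ dense ⟩
    length (half b L) + length (half (not b) L) ≡⟨ length-half+half b L ⟩
    length L                                    ≤⟨ L≤ ⟩
    N + N                                       ∎)
    where open ≤-Reasoning

  connected : Connected L
  connected with length (half false L) ≤? N
  ... | no L₀≰ =
    connected-if-good-half false (<⇒≤ L₁<) (λ w _ → free-neighbour-if-few (half true L) L₁< w)
    where
    L₁< : length (half true L) < N
    L₁< = other-half-< false (≰⇒> L₀≰)
  ... | yes L₀≤ with isolated-or-not (half false L)
  ...   | inj₁ good₀ = connected-if-good-half true L₀≤ good₀
  ...   | inj₂ (w₀ , iso₀)
    with other-half-≤ false (isolated⇒dim≤length iso₀) | isolated-or-not (half true L)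
  ...     | L₁≤ | inj₁ good₁       = connected-if-good-half false L₁≤ good₁
  ...     | L₁≤ | inj₂ (w₁ , iso₁) = ⊥-elim (both-isolated⇒⊥ iso₀ iso₁ L₀≤ L₁≤)

data WalkIn {n} (C : List (Vertex n)) : Vertex n → Vertex n → Set where
  here : ∀ {x} → x ∈ C → WalkIn C x x
  step : ∀ {x y z} → WalkIn C x y → QAdj y z → z ∈ C → WalkIn C x z

connected⊆cluster : ∀ {n} {C L Z : List (Vertex n)} → C ⊆ L → ClosedIn L Z →
                    (∀ {x y} → x ∈ C → y ∈ C → WalkIn C x y) → ∀ {z} → z ∈ Z → z ∈ C → C ⊆ Z
connected⊆cluster {C = C} {Z = Z} C⊆L closed walk {z} z∈Z z∈C x∈C = along (walk z∈C x∈C)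
  where
  along : ∀ {y} → WalkIn C z y → y ∈ Z
  along (here _)         = z∈Z
  along (step w adj y∈C) = closed (along w) (C⊆L (end w)) adj (C⊆L y∈C)
    where
    end : ∀ {a b} → WalkIn C a b → b ∈ C
    end (here b∈)     = b∈
    end (step _ _ b∈) = b∈

-- A member of a C_{2h}-substructure cut, seen as a fault set: since both C_{2h} and Q_n are
-- bipartite, it has at most h vertices of each parity.
record Piece (n h : ℕ) : Set where
  field
    cover              : List (Vertex n)
    cover-length       : length cover ≤ h + h
    walk               : ∀ {x y} → x ∈ cover → y ∈ cover → WalkIn cover x y
    parityClass        : Bool → List (Vertex n)
    parityClass-length : ∀ b → length (parityClass b) ≤ h
    ∈parityClass       : ∀ {x} → x ∈ cover → x ∈ parityClass (parity x)

module Piece-union {N h} (h≥2 : 2 ≤ h) (N≥1 : 1 ≤ N) (Ps : List (Piece (suc N) h))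
                   (few : length Ps * h ≤ N) where
  open Piece

  L : List (Vertex (suc N))
  L = concatMap cover Ps

  ∈L⁻ : ∀ {x} → x ∈ L → ∃ λ P → P ∈ Ps × x ∈ cover P
  ∈L⁻ = find ∘ ∈-concatMap⁻ cover

  2mh≤2N : length Ps * (h + h) ≤ N + N
  2mh≤2N = subst (_≤ N + N) (sym (*-distribˡ-+ (length Ps) h h)) (+-mono-≤ few few)

  length-L : length L ≤ N + N
  length-L = ≤-trans (length-concatMap-≤ cover cover-length Ps) 2mh≤2N

  no-isolated : ∀ u → HasFreeNeighbour L u
  no-isolated u = free-neighbour L M u faulty⊆M
    (s≤s (≤-trans (length-concatMap-≤ class (λ P → parityClass-length P _) Ps) few))
    where
    class : Piece (suc N) h → List (Vertex (suc N))
    class P = parityClass P (not (parity u))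
    M : List (Vertex (suc N))
    M = concatMap class Ps
    faulty⊆M : ∀ {w} → QAdj u w → w ∈ L → w ∈ M
    faulty⊆M {w} adj w∈ with ∈L⁻ w∈
    ... | P , P∈ , w∈P = ∈-concatMap⁺ class (lose P∈
      (subst (λ b → w ∈ parityClass P b) (parity-QAdj {u = u} {w} adj) (∈parityClass P w∈P)))

  -- The piece meeting the cluster Z lies inside Z, so Z can stand in for its up to 2h vertices.
  cheaper-cover : ∀ (Qs : List (Piece (suc N) h)) → concatMap cover Qs ⊆ L → ∀ {Z} → ClosedIn L Z →
                  ∀ {z} → z ∈ Z → z ∈ concatMap cover Qs →
                  ∃ λ L′ → concatMap cover Qs ⊆ L′ × length L′ + (h + h) ≤ length Z + length Qs * (h + h)
  cheaper-cover (P ∷ Qs) Qs⊆L {Z} closed z∈Z z∈Qs with ∈-++⁻ (cover P) z∈Qs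
  ... | inj₁ z∈P = Z ++ concatMap cover Qs , ⊆Z++ , bound
    where
    open ≤-Reasoning
    P⊆Z : cover P ⊆ Z
    P⊆Z = connected⊆cluster (Qs⊆L ∘ ∈-++⁺ˡ) closed (walk P) z∈Z z∈P
    ⊆Z++ : concatMap cover (P ∷ Qs) ⊆ Z ++ concatMap cover Qs
    ⊆Z++ x∈ = [ ∈-++⁺ˡ ∘ P⊆Z , ∈-++⁺ʳ Z ]′ (∈-++⁻ (cover P) x∈)
    bound : length (Z ++ concatMap cover Qs) + (h + h) ≤ length Z + ((h + h) + length Qs * (h + h))
    bound = begin
      length (Z ++ concatMap cover Qs) + (h + h)        ≡⟨ cong (_+ (h + h)) (length-++ Z) ⟩
      length Z + length (concatMap cover Qs) + (h + h)  ≤⟨ +-monoˡ-≤ (h + h) (+-monoʳ-≤ (length Z)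
                                                             (length-concatMap-≤ cover cover-length Qs)) ⟩
      length Z + length Qs * (h + h) + (h + h)          ≡⟨ xy∙z≈x∙zy (length Z) _ (h + h) ⟩
      length Z + ((h + h) + length Qs * (h + h))        ∎
  ... | inj₂ z∈Qs′ =
    let L₃ , Qs⊆L₃ , bound₃ = cheaper-cover Qs (Qs⊆L ∘ ∈-++⁺ʳ (cover P)) closed z∈Z z∈Qs′ in
    cover P ++ L₃ ,
    (λ x∈ → [ ∈-++⁺ˡ , ∈-++⁺ʳ (cover P) ∘ Qs⊆L₃ ]′ (∈-++⁻ (cover P) x∈)) , (begin
      length (cover P ++ L₃) + (h + h)       ≡⟨ cong (_+ (h + h)) (length-++ (cover P)) ⟩
      length (cover P) + length L₃ + (h + h) ≡⟨ +-assoc (length (cover P)) _ _ ⟩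
      length (cover P) + (length L₃ + (h + h)) ≤⟨ +-mono-≤ (cover-length P) bound₃ ⟩
      (h + h) + (length Z + length Qs * (h + h)) ≡⟨ x∙yz≈y∙xz (h + h) (length Z) _ ⟩
      length Z + ((h + h) + length Qs * (h + h)) ∎)
    where open ≤-Reasoning

  shrinks : SmallClusterShrinks (N + N) L
  shrinks Z Z≤2 (z , z∈Z , z∈L) closed =
    let L′ , L⊆L′ , bound = cheaper-cover Ps id closed z∈Z z∈L in
    L′ , L⊆L′ , +-cancelʳ-< 2 (length L′) (N + N) (begin-strict
      length L′ + 2                  <⟨ +-monoʳ-< (length L′) (+-mono-<-≤ h≥2 (≤-trans (s≤s z≤n) h≥2)) ⟩
      length L′ + (h + h)            ≤⟨ bound ⟩
      length Z + length Ps * (h + h) ≤⟨ +-mono-≤ Z≤2 2mh≤2N ⟩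
      2 + (N + N)                    ≡⟨ +-comm 2 (N + N) ⟩
      N + N + 2                      ∎)
    where open ≤-Reasoning

  connected : Connected L
  connected = TightFaults.connected N≥1 length-L no-isolated shrinks

-- Subgraphs of even cycles

odd : ℕ → Bool
odd zero    = false
odd (suc n) = not (odd n)

fromBool : Bool → ℕ
fromBool false = 0
fromBool true  = 1

⌊n/2⌋+⌊n/2⌋+odd : ∀ t → ⌊ t /2⌋ + ⌊ t /2⌋ + fromBool (odd t) ≡ t
⌊n/2⌋+⌊n/2⌋+odd zero          = refl
⌊n/2⌋+⌊n/2⌋+odd (suc zero)    = refl
⌊n/2⌋+⌊n/2⌋+odd (suc (suc t)) = begin
  suc ⌊ t /2⌋ + suc ⌊ t /2⌋ + fromBool (not (not (odd t)))
    ≡⟨ cong (λ b → suc ⌊ t /2⌋ + suc ⌊ t /2⌋ + fromBool b) (not-involutive (odd t)) ⟩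
  suc (⌊ t /2⌋ + suc ⌊ t /2⌋ + fromBool (odd t))
    ≡⟨ cong (λ m → suc (m + fromBool (odd t))) (+-suc ⌊ t /2⌋ ⌊ t /2⌋) ⟩
  suc (suc (⌊ t /2⌋ + ⌊ t /2⌋ + fromBool (odd t)))
    ≡⟨ cong (λ m → suc (suc m)) (⌊n/2⌋+⌊n/2⌋+odd t) ⟩
  suc (suc t) ∎
  where open ≡-Reasoning

⌊suc/2⌋≡ : ∀ s → ⌊ suc s /2⌋ ≡ ⌊ s /2⌋ + fromBool (odd s)
⌊suc/2⌋≡ zero          = refl
⌊suc/2⌋≡ (suc zero)    = refl
⌊suc/2⌋≡ (suc (suc s)) =
  trans (cong suc (⌊suc/2⌋≡ s)) (cong (λ b → suc ⌊ s /2⌋ + fromBool b) (sym (not-involutive (odd s))))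

odd-double : ∀ h → odd (h + h) ≡ false
odd-double zero    = refl
odd-double (suc h) = begin
  not (odd (h + suc h))   ≡⟨ cong (not ∘ odd) (+-suc h h) ⟩
  not (not (odd (h + h))) ≡⟨ not-involutive _ ⟩
  odd (h + h)             ≡⟨ odd-double h ⟩
  false                   ∎
  where open ≡-Reasoning

odd-successor-mod : ∀ {h k} → suc k ≡ h + h → ∀ {a} → a < suc k → odd ((a + 1) % suc k) ≡ not (odd a)
odd-successor-mod {h} {k} k≡ {a} a< with a + 1 <? suc k
... | yes a+1< = trans (cong odd (m<n⇒m%n≡m a+1<)) (cong odd (+-comm a 1))
... | no  a+1≮ = trans (cong odd (trans (cong (_% suc k) a+1≡) (n%n≡0 (suc k))))
                       (sym (trans (cong odd (trans (+-comm 1 a) (trans a+1≡ k≡))) (odd-double h)))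
  where
  a+1≡ : a + 1 ≡ suc k
  a+1≡ = ≤-antisym (subst (_≤ suc k) (+-comm 1 a) a<) (≮⇒≥ a+1≮)

CAdj-odd : ∀ {h k} → k ≡ h + h → ∀ {i j : Fin k} → CAdj k i j → odd (toℕ j) ≡ not (odd (toℕ i))
CAdj-odd {h} {suc k} k≡ {i} (inj₁ j≡) = trans (cong odd j≡) (odd-successor-mod {h} k≡ (toℕ<n i))
CAdj-odd {h} {suc k} k≡ {j = j} (inj₂ i≡) =
  ≡not⇒≡not (trans (cong odd i≡) (odd-successor-mod {h} k≡ (toℕ<n j)))

m+m<n+n⇒m<n : ∀ {s h} → s + s < h + h → s < h
m+m<n+n⇒m<n {s} {h} lt with s <? h
... | yes s<h = s<h
... | no  s≮h = ⊥-elim (<⇒≱ lt (+-mono-≤ (≮⇒≥ s≮h) (≮⇒≥ s≮h)))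

m<n⇒m+m+b<n+n : ∀ {s h} e → s < h → s + s + fromBool e < h + h
m<n⇒m+m+b<n+n {s} {h} e s<h = begin-strict
  s + s + fromBool e ≤⟨ +-monoʳ-≤ (s + s) (bit≤1 e) ⟩
  s + s + 1          ≡⟨ +-comm (s + s) 1 ⟩
  suc s + s          ≤⟨ +-monoˡ-≤ s s<h ⟩
  h + s              <⟨ +-monoʳ-< h s<h ⟩
  h + h              ∎
  where
  open ≤-Reasoning
  bit≤1 : ∀ e → fromBool e ≤ 1
  bit≤1 false = z≤n
  bit≤1 true  = s≤s z≤n

module _ {k} {S : SubOfCycle k} where
  open SubOfCycle S

  SReach-trans : ∀ {i j l} → SReach S i j → SReach S j l → SReach S i l
  SReach-trans r (here _)    = r
  SReach-trans r (step r′ e) = step (SReach-trans r r′) e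

  SReach-sym : ∀ {i j} → SReach S i j → SReach S j i
  SReach-sym (here Pi) = here Pi
  SReach-sym (step {j = j} {l} r (inj₁ e)) =
    SReach-trans (step (here (E-endʳ j l e)) (inj₂ e)) (SReach-sym r)
  SReach-sym (step {j = j} {l} r (inj₂ e)) =
    SReach-trans (step (here (E-endˡ l j e)) (inj₁ e)) (SReach-sym r)

successor-CAdj : ∀ {k} {i j : Fin (suc k)} → toℕ j ≡ suc (toℕ i) → CAdj (suc k) i j
successor-CAdj {k} {i} {j} j≡ = inj₁ (trans j≡ (sym (trans
  (m<n⇒m%n≡m (subst (_< suc k) (trans j≡ (+-comm 1 (toℕ i))) (toℕ<n j))) (+-comm (toℕ i) 1))))

consecutive⇒connected : ∀ {k} (S : SubOfCycle (suc k)) → SubOfCycle.P S zero ≡ true →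
  (∀ {i j} → toℕ j ≡ suc (toℕ i) → SubOfCycle.P S j ≡ true → SubOfCycle.E S i j ≡ true) → ConnectedSub S
consecutive⇒connected {k} S P0 consecutive =
  (zero , P0) , λ i j Pi Pj → SReach-trans (SReach-sym (from0 i Pi)) (from0 j Pj)
  where
  open SubOfCycle S
  from0< : ∀ t (t< : t < suc k) → P (fromℕ< t<) ≡ true → SReach S zero (fromℕ< t<)
  from0< zero    _  _  = here P0
  from0< (suc t) t< Pj = step (from0< t (<-trans (n<1+n t) t<) (E-endˡ _ _ e)) (inj₁ e)
    where
    e : E (fromℕ< (<-trans (n<1+n t) t<)) (fromℕ< t<) ≡ true
    e = consecutive (trans (toℕ-fromℕ< t<) (cong suc (sym (toℕ-fromℕ< _)))) Pj
  from0 : ∀ i → P i ≡ true → SReach S zero i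
  from0 i Pi = subst (SReach S zero) (fromℕ<-toℕ i (toℕ<n i))
    (from0< (toℕ i) (toℕ<n i) (subst (λ t → P t ≡ true) (sym (fromℕ<-toℕ i (toℕ<n i))) Pi))

module SubCycleCopyPiece {n h k} (k≡ : k ≡ h + h) (c : SubCycleCopy n k) where
  open SubCycleCopy c
  open SubOfCycle S

  P? : Decidable (λ i → P i ≡ true)
  P? i = P i ≟ᴮ true

  cover : List (Vertex n)
  cover = map f (filter P? (allFin k))

  ∈cover⁺ : ∀ {i} → P i ≡ true → f i ∈ cover
  ∈cover⁺ {i} Pi = ∈-map⁺ f (∈-filter⁺ P? (∈-allFin i) Pi)

  ∈cover⁻ : ∀ {x} → x ∈ cover → ∃ λ i → P i ≡ true × f i ≡ x
  ∈cover⁻ x∈ with ∈-map⁻ f x∈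
  ... | i , i∈ , refl = i , proj₂ (∈-filter⁻ P? {xs = allFin k} i∈) , refl

  walk : ∀ {i j} → SReach S i j → WalkIn cover (f i) (f j)
  walk (here Pi) = here (∈cover⁺ Pi)
  walk (step {j = j} {l} r (inj₁ e)) = step (walk r) (edges j l e) (∈cover⁺ (E-endʳ j l e))
  walk (step {j = j} {l} r (inj₂ e)) =
    step (walk r) (QAdj-sym {u = f l} {f j} (edges l j e)) (∈cover⁺ (E-endˡ l j e))

  edge-flips : ∀ {j l} → E j l ≡ true ⊎ E l j ≡ true →
               odd (toℕ l) ≡ not (odd (toℕ j)) × parity (f l) ≡ not (parity (f j))
  edge-flips {j} {l} (inj₁ e) = CAdj-odd {h} k≡ (E⊆C j l e) , parity-QAdj {u = f j} {f l} (edges j l e)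
  edge-flips {j} {l} (inj₂ e) =
    ≡not⇒≡not (CAdj-odd {h} k≡ (E⊆C l j e)) , ≡not⇒≡not (parity-QAdj {u = f l} {f j} (edges l j e))

  base : Fin k
  base = proj₁ (proj₁ conn)

  offset : Bool
  offset = parity (f base) xor odd (toℕ base)

  -- The parity of f j and the oddness of j both flip along every edge, so on the connected
  -- subgraph they differ by a constant.
  odd≡parity-xor : ∀ {j} → SReach S base j → odd (toℕ j) ≡ parity (f j) xor offset
  odd≡parity-xor (here _) = sym (trans (sym (xor-assoc (parity (f base)) _ _))
    (trans (cong (_xor odd (toℕ base)) (xor-same (parity (f base)))) (xor-identityˡ _)))
  odd≡parity-xor (step {j = j} {l} r e) = begin
    odd (toℕ l)                    ≡⟨ proj₁ (edge-flips e) ⟩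
    not (odd (toℕ j))              ≡⟨ cong not (odd≡parity-xor r) ⟩
    not (parity (f j) xor offset)  ≡⟨ not-distribˡ-xor (parity (f j)) offset ⟩
    not (parity (f j)) xor offset  ≡⟨ cong (_xor offset) (sym (proj₂ (edge-flips e))) ⟩
    parity (f l) xor offset        ∎
    where open ≡-Reasoning

  -- The vertices of parity b sit at the indices 2s + (b xor offset) with s < h.
  classIndex : Fin h → Bool → Fin k
  classIndex s e = fromℕ< (subst (toℕ s + toℕ s + fromBool e <_) (sym k≡) (m<n⇒m+m+b<n+n e (toℕ<n s)))

  class : Bool → List (Vertex n)
  class b = map (λ s → f (classIndex s (b xor offset))) (allFin h)

  ∈class : ∀ {x} → x ∈ cover → x ∈ class (parity x)
  ∈class x∈ with ∈cover⁻ x∈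
  ... | i , Pi , refl = subst (λ t → f t ∈ class (parity (f i))) index≡ (∈-map⁺ _ (∈-allFin s))
    where
    s< : ⌊ toℕ i /2⌋ < h
    s< = m+m<n+n⇒m<n (≤-<-trans (m≤m+n _ (fromBool (odd (toℕ i))))
      (subst (_< h + h) (sym (⌊n/2⌋+⌊n/2⌋+odd (toℕ i))) (subst (toℕ i <_) k≡ (toℕ<n i))))
    s : Fin h
    s = fromℕ< s<
    index≡ : classIndex s (parity (f i) xor offset) ≡ i
    index≡ = toℕ-injective (begin
      toℕ (classIndex s (parity (f i) xor offset))
        ≡⟨ toℕ-fromℕ< _ ⟩
      toℕ s + toℕ s + fromBool (parity (f i) xor offset)
        ≡⟨ cong₂ (λ a b → a + a + fromBool b) (toℕ-fromℕ< s<)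
                 (sym (odd≡parity-xor (proj₂ conn base i (proj₂ (proj₁ conn)) Pi))) ⟩
      ⌊ toℕ i /2⌋ + ⌊ toℕ i /2⌋ + fromBool (odd (toℕ i))
        ≡⟨ ⌊n/2⌋+⌊n/2⌋+odd (toℕ i) ⟩
      toℕ i ∎)
      where open ≡-Reasoning

  piece : Piece n h
  piece = record
    { cover              = cover
    ; cover-length       = begin
        length cover                           ≡⟨ length-map f (filter P? (allFin k)) ⟩
        length (filter P? (allFin k))          ≤⟨ length-filter P? (allFin k) ⟩
        length (allFin k)                      ≡⟨ trans (length-tabulate id) k≡ ⟩
        h + h                                  ∎
    ; walk               = λ x∈ y∈ → connect (∈cover⁻ x∈) (∈cover⁻ y∈)
    ; parityClass        = class
    ; parityClass-length = λ b → ≤-reflexive (trans (length-map _ (allFin h)) (length-tabulate id))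
    ; ∈parityClass       = ∈class
    }
    where
    open ≤-Reasoning
    connect : ∀ {x y} → (∃ λ i → P i ≡ true × f i ≡ x) → (∃ λ j → P j ≡ true × f j ≡ y) →
              WalkIn cover x y
    connect (i , Pi , refl) (j , Pj , refl) = walk (proj₂ conn i j Pi Pj)

CAdj? : ∀ k (i j : Fin k) → Dec (CAdj k i j)
CAdj? (suc k) i j = (toℕ j ≟ (toℕ i + 1) % suc k) ⊎-dec (toℕ i ≟ (toℕ j + 1) % suc k)

wholeCycle : ∀ k → SubOfCycle k
wholeCycle k = record
  { P      = λ _ → true
  ; E      = λ i j → does (CAdj? k i j)
  ; E⊆C    = λ i j → does⇒ (CAdj? k i j)
  ; E-endˡ = λ _ _ _ → refl
  ; E-endʳ = λ _ _ _ → refl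
  }

cycle⇒substructure : ∀ {n k} → CycleCopy n (suc k) → SubCycleCopy n (suc k)
cycle⇒substructure {k = k} c = record
  { S     = wholeCycle (suc k)
  ; conn  = consecutive⇒connected (wholeCycle (suc k)) refl
              (λ j≡ _ → dec-true (CAdj? (suc k) _ _) (successor-CAdj j≡))
  ; f     = CycleCopy.f c
  ; inj   = λ i j _ _ → CycleCopy.inj c i j
  ; edges = λ i j e → CycleCopy.edges c i j (does⇒ (CAdj? (suc k) i j) e)
  }

-- Lower bounds

DisconnectedOrTrivial-resp : ∀ {n} {R R′ : Vertex n → Set} → (∀ {x} → R x → R′ x) →
                             (∀ {x} → R′ x → R x) → DisconnectedOrTrivial R → DisconnectedOrTrivial R′
DisconnectedOrTrivial-resp R⇒R′ R′⇒R (inj₁ (u , v , u∉ , v∉ , ¬u⇝v)) =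
  inj₁ (u , v , u∉ ∘ R′⇒R , v∉ ∘ R′⇒R , ¬u⇝v ∘ Reach-anti R⇒R′)
DisconnectedOrTrivial-resp R⇒R′ R′⇒R (inj₂ (u , u∉ , only)) =
  inj₂ (u , u∉ ∘ R′⇒R , λ v v∉ → only v (v∉ ∘ R⇒R′))

connected⇒¬cut : ∀ {n} {L : List (Vertex n)} → Connected L → (∀ u → HasFreeNeighbour L u) →
                 ¬ DisconnectedOrTrivial (_∈ L)
connected⇒¬cut conn _    (inj₁ (u , v , u∉ , v∉ , ¬u⇝v)) = ¬u⇝v (conn u v u∉ v∉)
connected⇒¬cut _    free (inj₂ (u , u∉ , only)) with free u
... | w , adj , w∉ with only w w∉
...   | refl = QAdj-irrefl w adj

few-substructures-no-cut : ∀ {N h} → 2 ≤ h → 1 ≤ N → (F : List (SubCycleCopy (suc N) (h + h))) →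
                           length F * h ≤ N → ¬ IsSubstructureCut (suc N) (h + h) F
few-substructures-no-cut {N} {h} h≥2 N≥1 F few =
  connected⇒¬cut Pieces.connected Pieces.no-isolated ∘ DisconnectedOrTrivial-resp union⇒∈ ∈⇒union
  where
  toPiece : SubCycleCopy (suc N) (h + h) → Piece (suc N) h
  toPiece = SubCycleCopyPiece.piece refl
  module Pieces = Piece-union h≥2 N≥1 (map toPiece F)
                              (subst (λ m → m * h ≤ N) (sym (length-map toPiece F)) few)
  union⇒∈ : ∀ {x} → UnionSubCycle F x → x ∈ Pieces.L
  union⇒∈ (c , c∈ , i , Pi , refl) =
    ∈-concatMap⁺ Piece.cover (lose (∈-map⁺ toPiece c∈) (SubCycleCopyPiece.∈cover⁺ {h = h} refl c Pi))
  ∈⇒union : ∀ {x} → x ∈ Pieces.L → UnionSubCycle F x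
  ∈⇒union x∈ with Pieces.∈L⁻ x∈
  ... | P , P∈ , x∈P with ∈-map⁻ toPiece P∈
  ...   | c , c∈ , refl =
    let i , Pi , eq = SubCycleCopyPiece.∈cover⁻ {h = h} refl c x∈P in c , c∈ , i , Pi , eq

≤ceilDiv⇒ : ∀ {a m k} → m ≤ ceilDiv a (suc k) → m * suc k ≤ a + k
≤ceilDiv⇒ {a} {m} {k} m≤ = ≤-trans (*-monoˡ-≤ (suc k) m≤) (m/n*n≤m (a + k) (suc k))

⇒≤ceilDiv : ∀ {a m k} → m * suc k ≤ a + k → m ≤ ceilDiv a (suc k)
⇒≤ceilDiv {a} {m} {k} m*k≤ = subst (_≤ ceilDiv a (suc k)) (m*n/n≡m m (suc k)) (/-monoˡ-≤ (suc k) m*k≤)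

<ceilDiv⇒*< : ∀ {n m h} → 1 ≤ h → m < ceilDiv (2 * n) (h + h) → m * h < n
<ceilDiv⇒*< {n} {m} {suc h} _ m< = m+m<n+n⇒m<n (+-cancelˡ-< k′ _ _ (begin-strict
  k′ + (m * suc h + m * suc h) ≡⟨ cong (k′ +_) (sym (*-distribˡ-+ m (suc h) (suc h))) ⟩
  k′ + m * (suc h + suc h)     <⟨ n<1+n _ ⟩
  suc m * (suc h + suc h)      ≤⟨ ≤ceilDiv⇒ {2 * n} m< ⟩
  2 * n + k′                   ≡⟨ +-comm (2 * n) k′ ⟩
  k′ + 2 * n                   ≡⟨ cong (λ t → k′ + (n + t)) (+-identityʳ n) ⟩
  k′ + (n + n)                 ∎))
  where
  open ≤-Reasoning
  k′ : ℕ
  k′ = h + suc h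

*<⇒<ceilDiv : ∀ {n m h} → 1 ≤ h → m * h < n → m < ceilDiv (2 * n) (h + h)
*<⇒<ceilDiv {suc n} {m} {suc h} _ m*h< = ⇒≤ceilDiv {2 * suc n} (begin
  suc m * (suc h + suc h)            ≡⟨ cong (suc k′ +_) (*-distribˡ-+ m (suc h) (suc h)) ⟩
  suc (k′ + (m * suc h + m * suc h)) ≤⟨ s≤s (+-monoʳ-≤ k′ (+-mono-≤ mh≤n (m≤n⇒m≤1+n mh≤n))) ⟩
  suc (k′ + (n + suc n))             ≡⟨ cong suc (+-comm k′ (n + suc n)) ⟩
  suc (n + suc n + k′)               ≡⟨ cong (λ t → suc n + t + k′) (sym (+-identityʳ (suc n))) ⟩
  2 * suc n + k′                     ∎)
  where
  open ≤-Reasoning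
  k′ : ℕ
  k′ = h + suc h
  mh≤n : m * suc h ≤ n
  mh≤n = ≤-pred m*h<

substructure-lower-bound : ∀ {N h} → 2 ≤ h → 1 ≤ N → (F : List (SubCycleCopy (suc N) (h + h))) →
                           IsSubstructureCut (suc N) (h + h) F → ceilDiv (2 * suc N) (h + h) ≤ length F
substructure-lower-bound {N} {h} h≥2 N≥1 F cut with ceilDiv (2 * suc N) (h + h) ≤? length F
... | yes ≤F = ≤F
... | no  ≰F =
  ⊥-elim (few-substructures-no-cut h≥2 N≥1 F
    (≤-pred (<ceilDiv⇒*< (≤-trans (s≤s z≤n) h≥2) (≰⇒> ≰F))) cut)

structure-lower-bound : ∀ {N h} → 2 ≤ h → 1 ≤ N → (F : List (CycleCopy (suc N) (h + h))) →
                        IsStructureCut (suc N) (h + h) F → ceilDiv (2 * suc N) (h + h) ≤ length F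
structure-lower-bound {N} {suc h} h≥2 N≥1 F cut =
  subst (ceilDiv (2 * suc N) (suc h + suc h) ≤_) (length-map cycle⇒substructure F)
    (substructure-lower-bound h≥2 N≥1 (map cycle⇒substructure F) (DisconnectedOrTrivial-resp to from cut))
  where
  to : ∀ {x} → UnionCycle F x → UnionSubCycle (map cycle⇒substructure F) x
  to (c , c∈ , i , eq) = cycle⇒substructure c , ∈-map⁺ cycle⇒substructure c∈ , i , refl , eq
  from : ∀ {x} → UnionSubCycle (map cycle⇒substructure F) x → UnionCycle F x
  from (_ , c′∈ , i , _ , eq) with ∈-map⁻ cycle⇒substructure c′∈
  ... | c , c∈ , refl = c , c∈ , i , eq

-- Upper bound

bitsAt : ∀ {n} → (ℕ → Bool) → Vertex n
bitsAt p = tabulateᵛ (p ∘ toℕ)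

lookup-bitsAt : ∀ {n} (p : ℕ → Bool) (i : Fin n) → lookup (bitsAt p) i ≡ p (toℕ i)
lookup-bitsAt p = lookup∘tabulate (p ∘ toℕ)

lookup-ext : ∀ {n} {u v : Vertex n} → (∀ i → lookup u i ≡ lookup v i) → u ≡ v
lookup-ext {u = u} {v} eq =
  trans (sym (tabulate∘lookup u)) (trans (tabulate-cong eq) (tabulate∘lookup v))

bitsAt-toggle : ∀ {n} {p q : ℕ → Bool} (x : Fin n) → q (toℕ x) ≡ not (p (toℕ x)) →
                (∀ {y} → y ≢ toℕ x → q y ≡ p y) → bitsAt q ≡ toggle x (bitsAt p)
bitsAt-toggle {p = p} {q} x at-x elsewhere = lookup-ext λ i → trans (lookup-bitsAt q i) (lookup≡ i)
  where
  lookup≡ : ∀ i → q (toℕ i) ≡ lookup (toggle x (bitsAt p)) i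
  lookup≡ i with x ≟ᶠ i
  ... | yes refl =
    trans at-x (trans (cong not (sym (lookup-bitsAt p x))) (sym (lookup-toggle-≡ x (bitsAt p))))
  ... | no  x≢i  =
    trans (elsewhere (x≢i ∘ sym ∘ toℕ-injective))
          (sym (trans (lookup-toggle-≢ (bitsAt p) x≢i) (lookup-bitsAt p i)))

-- stair a r is e_a, or e_a + e_{a+1} when r holds; stairs trace the path
-- e_c, e_c + e_{c+1}, e_{c+1}, e_{c+1} + e_{c+2}, … through the neighbours of the zero vector.
stairBit : ℕ → Bool → ℕ → Bool
stairBit a false y = does (y ≟ a)
stairBit a true  y = does (y ≟ a) ∨ does (y ≟ suc a)

stair : ∀ {n} → ℕ → Bool → Vertex n
stair a r = bitsAt (stairBit a r)

stairBit-self : ∀ a r → stairBit a r a ≡ true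
stairBit-self a false = dec-true (a ≟ a) refl
stairBit-self a true  = cong (_∨ does (a ≟ suc a)) (dec-true (a ≟ a) refl)

stairBit-suc : ∀ a r → stairBit a r (suc a) ≡ r
stairBit-suc a false = dec-false (suc a ≟ a) (1+n≢n)
stairBit-suc a true  =
  trans (cong (_∨ does (suc a ≟ suc a)) (dec-false (suc a ≟ a) 1+n≢n)) (dec-true (suc a ≟ suc a) refl)

stairBit-true⇒ : ∀ a r y → stairBit a r y ≡ true → y ≡ a ⊎ (r ≡ true × y ≡ suc a)
stairBit-true⇒ a false y bit = inj₁ (does⇒ (y ≟ a) bit)
stairBit-true⇒ a true  y bit with ∨≡true⇒ (does (y ≟ a)) bit
... | inj₁ y≡a   = inj₁ (does⇒ (y ≟ a) y≡a)
... | inj₂ y≡a+1 = inj₂ (refl , does⇒ (y ≟ suc a) y≡a+1)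

stair-adjacent₁ : ∀ {n} a → suc a < n → QAdj (stair {n} a false) (stair a true)
stair-adjacent₁ a a+1< = subst (QAdj (stair a false)) (sym stair≡) (QAdj-toggle x (stair a false))
  where
  x : Fin _
  x = fromℕ< a+1<
  stair≡ : stair a true ≡ toggle x (stair a false)
  stair≡ = bitsAt-toggle x
    (trans (cong (stairBit a true) (toℕ-fromℕ< a+1<)) (trans (stairBit-suc a true)
           (cong not (sym (trans (cong (stairBit a false) (toℕ-fromℕ< a+1<)) (stairBit-suc a false))))))
    (λ {y} y≢ → trans (cong (does (y ≟ a) ∨_)
                            (dec-false (y ≟ suc a) (y≢ ∘ flip trans (sym (toℕ-fromℕ< a+1<)))))
                      (∨-identityʳ _))

stair-adjacent₂ : ∀ {n} a → suc a < n → QAdj (stair {n} a true) (stair (suc a) false)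
stair-adjacent₂ a a+1< = subst (QAdj (stair a true)) (sym stair≡) (QAdj-toggle x (stair a true))
  where
  a< : a < _
  a< = <-trans (n<1+n a) a+1<
  x : Fin _
  x = fromℕ< a<
  stair≡ : stair (suc a) false ≡ toggle x (stair a true)
  stair≡ = bitsAt-toggle x
    (trans (cong (stairBit (suc a) false) (toℕ-fromℕ< a<)) (trans (dec-false (a ≟ suc a) (1+n≢n ∘ sym))
           (cong not (sym (trans (cong (stairBit a true) (toℕ-fromℕ< a<)) (stairBit-self a true))))))
    (λ {y} y≢ → cong (_∨ does (y ≟ suc a))
                     (sym (dec-false (y ≟ a) (y≢ ∘ flip trans (sym (toℕ-fromℕ< a<))))))

lookup-stair : ∀ {n} a r {y} (y< : y < n) → lookup (stair {n} a r) (fromℕ< y<) ≡ stairBit a r y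
lookup-stair a r y< = trans (lookup-bitsAt (stairBit a r) (fromℕ< y<)) (cong (stairBit a r) (toℕ-fromℕ< y<))

stairBit-cong : ∀ {n} a r a′ r′ {y} → stair {n} a r ≡ stair a′ r′ → (y< : y < n) →
                stairBit a r y ≡ stairBit a′ r′ y
stairBit-cong a r a′ r′ eq y< =
  trans (sym (lookup-stair a r y<)) (trans (cong (λ v → lookup v (fromℕ< y<)) eq) (lookup-stair a′ r′ y<))

stair-injective : ∀ {n a a′ r r′} → a < n → a′ < n → (r ≡ true → suc a < n) → (r′ ≡ true → suc a′ < n) →
                  stair {n} a r ≡ stair a′ r′ → a ≡ a′ × r ≡ r′
stair-injective {n} {a} {a′} {r} {r′} a< a′< suc-a< suc-a′< eq with a≡a′
  where
  a≡a′ : a ≡ a′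
  a≡a′ with stairBit-true⇒ a′ r′ a (trans (sym (stairBit-cong a r a′ r′ eq a<)) (stairBit-self a r))
          | stairBit-true⇒ a r a′ (trans (stairBit-cong a r a′ r′ eq a′<) (stairBit-self a′ r′))
  ... | inj₁ a≡         | _             = a≡
  ... | inj₂ _          | inj₁ a′≡      = sym a′≡
  ... | inj₂ (_ , a≡) | inj₂ (_ , a′≡) = ⊥-elim (<⇒≢ (m<n⇒m<1+n (n<1+n a)) (trans a≡ (cong suc a′≡)))
... | refl = refl , r≡r′ r r′ suc-a< suc-a′< eq
  where
  r≡r′ : ∀ b b′ → (b ≡ true → suc a < n) → (b′ ≡ true → suc a < n) → stair a b ≡ stair a b′ → b ≡ b′
  r≡r′ false false _      _       _  = refl
  r≡r′ true  b′    suc-a< _       eq =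
    trans (sym (stairBit-suc a true)) (trans (stairBit-cong a true a b′ eq (suc-a< refl)) (stairBit-suc a b′))
  r≡r′ false true  _      suc-a′< eq =
    trans (sym (stairBit-suc a false)) (trans (stairBit-cong a false a true eq (suc-a′< refl)) (stairBit-suc a true))

stair≢replicate-false : ∀ {n a r} → a < n → stair {n} a r ≢ replicate n false
stair≢replicate-false {n} {a} {r} a< eq = not-¬ refl (begin
  false                                  ≡⟨ sym (lookup-replicate (fromℕ< a<) false) ⟩
  lookup (replicate n false) (fromℕ< a<) ≡⟨ cong (λ v → lookup v (fromℕ< a<)) (sym eq) ⟩
  lookup (stair a r) (fromℕ< a<)         ≡⟨ lookup-stair a r a< ⟩
  stairBit a r a                         ≡⟨ stairBit-self a r ⟩
  not false                              ∎)
  where open ≡-Reasoning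

stair≢replicate-true : ∀ {n a r} → 3 ≤ n → stair {n} a r ≢ replicate n true
stair≢replicate-true {n} {a} {r} n≥3 eq with stairBit-true⇒ a r 0 (bit-set (≤-trans (s≤s z≤n) n≥3))
                                            | stairBit-true⇒ a r 2 (bit-set n≥3)
  where
  bit-set : ∀ {y} (y< : y < n) → stairBit a r y ≡ true
  bit-set y< = trans (sym (lookup-stair a r y<))
                     (trans (cong (λ v → lookup v (fromℕ< y<)) eq) (lookup-replicate (fromℕ< y<) true))
... | inj₁ refl | inj₁ ()
... | inj₁ refl | inj₂ (_ , ())

toggle-zeros≡stair : ∀ {n} (i : Fin n) → toggle i (replicate n false) ≡ stair (toℕ i) false
toggle-zeros≡stair {n} i = sym (trans
  (bitsAt-toggle i (dec-true (toℕ i ≟ toℕ i) refl) (λ {y} y≢ → dec-false (y ≟ toℕ i) y≢))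
  (cong (toggle i) zeros≡))
  where
  zeros≡ : bitsAt (λ _ → false) ≡ replicate n false
  zeros≡ = lookup-ext λ j → trans (lookup-bitsAt _ j) (sym (lookup-replicate j false))

stair-step : ∀ {n} c s → c + ⌊ suc (suc s) /2⌋ < n →
             QAdj (stair {n} (c + ⌊ s /2⌋) (odd s)) (stair (c + ⌊ suc s /2⌋) (odd (suc s)))
stair-step {n} c s bound with odd s in odd≡
... | false = subst (λ t → QAdj (stair {n} (c + ⌊ s /2⌋) false) (stair (c + t) true)) (sym ⌊s+1/2⌋≡)
                    (stair-adjacent₁ (c + ⌊ s /2⌋) (subst (_< n) (+-suc c ⌊ s /2⌋) bound))
  where
  ⌊s+1/2⌋≡ : ⌊ suc s /2⌋ ≡ ⌊ s /2⌋
  ⌊s+1/2⌋≡ = trans (⌊suc/2⌋≡ s) (trans (cong (λ b → ⌊ s /2⌋ + fromBool b) odd≡) (+-identityʳ _))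
... | true  = subst (λ t → QAdj (stair {n} (c + ⌊ s /2⌋) true) (stair t false)) (sym c+⌊s+1/2⌋≡)
                    (stair-adjacent₂ (c + ⌊ s /2⌋) (subst (_< n) (+-suc c ⌊ s /2⌋) bound))
  where
  c+⌊s+1/2⌋≡ : c + ⌊ suc s /2⌋ ≡ suc (c + ⌊ s /2⌋)
  c+⌊s+1/2⌋≡ = trans (cong (c +_) (trans (⌊suc/2⌋≡ s)
                                       (trans (cong (λ b → ⌊ s /2⌋ + fromBool b) odd≡) (+-comm _ 1))))
                     (+-suc c ⌊ s /2⌋)

module Staircase {n} (k c : ℕ) (c<n : c < n) where

  InRange : Fin (suc k) → Set
  InRange t = c + ⌊ suc (toℕ t) /2⌋ < n

  inRange? : ∀ (t : Fin (suc k)) → Dec (InRange t)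
  inRange? t = c + ⌊ suc (toℕ t) /2⌋ <? n

  consecutive? : ∀ (t t′ : Fin (suc k)) → Dec (InRange t′ × toℕ t′ ≡ suc (toℕ t))
  consecutive? t t′ = inRange? t′ ×-dec (toℕ t′ ≟ suc (toℕ t))

  InRange-pred : ∀ {t t′ : Fin (suc k)} → toℕ t′ ≡ suc (toℕ t) → InRange t′ → InRange t
  InRange-pred {t} t′≡ =
    ≤-<-trans (+-monoʳ-≤ c (⌊n/2⌋-mono (subst (suc (toℕ t) ≤_) (cong suc (sym t′≡)) (n≤1+n _))))

  path : SubOfCycle (suc k)
  path = record
    { P      = λ t → does (inRange? t)
    ; E      = λ t t′ → does (consecutive? t t′)
    ; E⊆C    = λ t t′ e → successor-CAdj (proj₂ (does⇒ (consecutive? t t′) e))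
    ; E-endˡ = λ t t′ e → let r , t′≡ = does⇒ (consecutive? t t′) e in
                           dec-true (inRange? t) (InRange-pred t′≡ r)
    ; E-endʳ = λ t t′ e → dec-true (inRange? t′) (proj₁ (does⇒ (consecutive? t t′) e))
    }

  vertex : Fin (suc k) → Vertex n
  vertex t = stair (c + ⌊ toℕ t /2⌋) (odd (toℕ t))

  low< : ∀ {t} → InRange t → c + ⌊ toℕ t /2⌋ < n
  low< {t} = ≤-<-trans (+-monoʳ-≤ c (⌊n/2⌋-mono (n≤1+n (toℕ t))))

  high< : ∀ {t} → InRange t → odd (toℕ t) ≡ true → suc (c + ⌊ toℕ t /2⌋) < n
  high< {t} bound odd≡ = subst (_< n) (trans (cong (c +_) ⌊t+1/2⌋≡) (+-suc c _)) bound
    where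
    ⌊t+1/2⌋≡ : ⌊ suc (toℕ t) /2⌋ ≡ suc ⌊ toℕ t /2⌋
    ⌊t+1/2⌋≡ =
      trans (⌊suc/2⌋≡ (toℕ t)) (trans (cong (λ b → ⌊ toℕ t /2⌋ + fromBool b) odd≡) (+-comm _ 1))

  vertex-injective : ∀ (t t′ : Fin (suc k)) → does (inRange? t) ≡ true → does (inRange? t′) ≡ true →
                     vertex t ≡ vertex t′ → t ≡ t′
  vertex-injective t t′ Pt Pt′ eq
    with stair-injective (low< r) (low< r′) (high< r) (high< r′) eq
    where
    r : InRange t
    r = does⇒ (inRange? t) Pt
    r′ : InRange t′
    r′ = does⇒ (inRange? t′) Pt′
  ... | a≡ , odd≡ = toℕ-injective (begin
    toℕ t                                                ≡⟨ sym (⌊n/2⌋+⌊n/2⌋+odd (toℕ t)) ⟩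
    ⌊ toℕ t /2⌋ + ⌊ toℕ t /2⌋ + fromBool (odd (toℕ t))    ≡⟨ cong₂ (λ x b → x + x + fromBool b)
                                                              (+-cancelˡ-≡ c _ _ a≡) odd≡ ⟩
    ⌊ toℕ t′ /2⌋ + ⌊ toℕ t′ /2⌋ + fromBool (odd (toℕ t′)) ≡⟨ ⌊n/2⌋+⌊n/2⌋+odd (toℕ t′) ⟩
    toℕ t′                                               ∎)
    where open ≡-Reasoning

  vertex-step : ∀ (t t′ : Fin (suc k)) → does (consecutive? t t′) ≡ true → QAdj (vertex t) (vertex t′)
  vertex-step t t′ e with does⇒ (consecutive? t t′) e
  ... | bound , t′≡ = subst (λ x → QAdj (vertex t) (stair (c + ⌊ x /2⌋) (odd x))) (sym t′≡)
                            (stair-step c (toℕ t) (subst (λ x → c + ⌊ suc x /2⌋ < n) t′≡ bound))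

  copy : SubCycleCopy n (suc k)
  copy = record
    { S     = path
    ; conn  = consecutive⇒connected path (dec-true (inRange? zero) (subst (_< n) (sym (+-identityʳ c)) c<n))
                (λ {t} {t′} t′≡ Pt′ → dec-true (consecutive? t t′) (does⇒ (inRange? t′) Pt′ , t′≡))
    ; f     = vertex
    ; inj   = vertex-injective
    ; edges = vertex-step
    }

  ∈copy⇒stair : ∀ {x} → InSubCycleCopy copy x → ∃ λ a → ∃ λ r → a < n × stair a r ≡ x
  ∈copy⇒stair (t , Pt , refl) = c + ⌊ toℕ t /2⌋ , odd (toℕ t) , low< (does⇒ (inRange? t) Pt) , refl

  stair∈copy : ∀ d → d + d < suc k → c + d < n → InSubCycleCopy copy (stair (c + d) false)
  stair∈copy d 2d< c+d< =
    t , dec-true (inRange? t) in-range , cong₂ (λ x b → stair (c + x) b) ⌊2d/2⌋≡ odd≡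
    where
    t : Fin (suc k)
    t = fromℕ< 2d<
    ⌊2d/2⌋≡ : ⌊ toℕ t /2⌋ ≡ d
    ⌊2d/2⌋≡ = trans (cong ⌊_/2⌋ (toℕ-fromℕ< 2d<)) (sym (n≡⌊n+n/2⌋ d))
    odd≡ : odd (toℕ t) ≡ false
    odd≡ = trans (cong odd (toℕ-fromℕ< 2d<)) (odd-double d)
    in-range : InRange t
    in-range = subst (λ x → c + x < n)
                     (trans (n≡⌈n+n/2⌉ d) (cong (λ x → ⌊ suc x /2⌋) (sym (toℕ-fromℕ< 2d<)))) c+d<

zeros≢ones : ∀ {n} → 1 ≤ n → replicate n false ≢ replicate n true
zeros≢ones {suc n} _ ()

-- Block j is the staircase through e_{j(h+1)}, …, e_{j(h+1)+h}: together the blocks contain every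
-- neighbour of the zero vector, but no vertex of weight above two.
module UpperBound {n} (h : ℕ) (n≥3 : 3 ≤ n) where

  m : ℕ
  m = ceilDiv (2 * n) (suc h + suc h)

  h≥1 : 1 ≤ suc h
  h≥1 = s≤s z≤n

  start< : (j : Fin m) → toℕ j * suc h < n
  start< j = <ceilDiv⇒*< h≥1 (toℕ<n j)

  block : Fin m → SubCycleCopy n (suc h + suc h)
  block j = Staircase.copy (h + suc h) (toℕ j * suc h) (start< j)

  F : List (SubCycleCopy n (suc h + suc h))
  F = map block (allFin m)

  length-F : length F ≡ m
  length-F = trans (length-map block (allFin m)) (length-tabulate id)

  zeros ones : Vertex n
  zeros = replicate n false
  ones  = replicate n true

  unions-are-stairs : ∀ {x} → UnionSubCycle F x → ∃ λ a → ∃ λ r → a < n × stair a r ≡ x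
  unions-are-stairs (c , c∈ , x∈c) with ∈-map⁻ block c∈
  ... | j , _ , refl = Staircase.∈copy⇒stair (h + suc h) (toℕ j * suc h) (start< j) x∈c

  zeros∉ : ¬ UnionSubCycle F zeros
  zeros∉ x∈ = let a , r , a< , eq = unions-are-stairs x∈ in stair≢replicate-false {a = a} {r} a< eq

  ones∉ : ¬ UnionSubCycle F ones
  ones∉ x∈ = let a , r , _ , eq = unions-are-stairs x∈ in stair≢replicate-true {a = a} {r} n≥3 eq

  neighbour∈ : ∀ i → UnionSubCycle F (toggle i zeros)
  neighbour∈ i = block j , ∈-map⁺ block (∈-allFin j) ,
    subst (InSubCycleCopy (block j)) (trans (cong (λ a → stair a false) position≡) (sym (toggle-zeros≡stair i)))
      (Staircase.stair∈copy (h + suc h) (toℕ j * suc h) (start< j) d 2d<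
                            (subst (_< n) (sym position≡) (toℕ<n i)))
    where
    q d : ℕ
    q = toℕ i / suc h
    d = toℕ i % suc h
    q< : q < m
    q< = *<⇒<ceilDiv h≥1 (≤-<-trans (m/n*n≤m (toℕ i) (suc h)) (toℕ<n i))
    j : Fin m
    j = fromℕ< q<
    position≡ : toℕ j * suc h + d ≡ toℕ i
    position≡ = trans (cong (λ x → x * suc h + d) (toℕ-fromℕ< q<))
                      (trans (+-comm (q * suc h) d) (sym (m≡m%n+[m/n]*n (toℕ i) (suc h))))
    2d< : d + d < suc h + suc h
    2d< = subst (_< suc h + suc h) (+-identityʳ (d + d)) (m<n⇒m+m+b<n+n false (m%n<n (toℕ i) (suc h)))

  zeros-trapped : ∀ {w} → Reach (UnionSubCycle F) zeros w → w ≡ zeros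
  zeros-trapped (here _) = refl
  zeros-trapped (step {x = x} r adj x∉) with zeros-trapped r
  ... | refl with QAdj⇒toggle zeros x adj
  ...   | i , refl = ⊥-elim (x∉ (neighbour∈ i))

  cut : IsSubstructureCut n (suc h + suc h) F
  cut = inj₁ (zeros , ones , zeros∉ , ones∉ ,
              zeros≢ones (≤-trans (s≤s z≤n) n≥3) ∘ sym ∘ zeros-trapped)

2∣⇒double : ∀ {k} → 2 ∣ k → ∃ λ h → k ≡ h + h
2∣⇒double (divides h refl) = h , trans (*-comm h 2) (cong (h +_) (+-identityʳ h))

3≤double⇒2≤ : ∀ {h} → 3 ≤ h + h → 2 ≤ h
3≤double⇒2≤ {h} 3≤ with 2 ≤? h
... | yes 2≤h = 2≤h
... | no  2≰h = ⊥-elim (<⇒≱ 3≤ (+-mono-≤ (≤-pred (≰⇒> 2≰h)) (≤-pred (≰⇒> 2≰h))))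

theorem18 : ∀ (n k : ℕ) → 3 ≤ n → 2 ∣ k → 3 ≤ k → k ≤ 2 ^ (n ∸ 1) →
    KappaGE n k (ceilDiv (2 * n) k) × KappaS≡ n k (ceilDiv (2 * n) k)
theorem18 (suc N) k n≥3@(s≤s N≥2) 2∣k k≥3 _ with 2∣⇒double 2∣k
... | h , refl with 3≤double⇒2≤ {h} k≥3
...   | h≥2@(s≤s {n = h′} _) =
  structure-lower-bound h≥2 N≥1 ,
  (UpperBound.F h′ n≥3 , UpperBound.cut h′ n≥3 , UpperBound.length-F h′ n≥3) ,
  substructure-lower-bound h≥2 N≥1
  where
  N≥1 : 1 ≤ N
  N≥1 = ≤-trans (s≤s z≤n) N≥2
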